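{- For every $S\subseteq\mathbb{Z}^+$ and all integers $n,r\ge 0$, the following hold: $$B_{n,S,r+1}=\sum_{s\in S}\binom{n}{s-1}B_{n-s+1,S,r},$$ $$(n+r)B_{n,S,r}=\sum_{s\in S}s\binom{n}{s}B_{n-s,S,r}+r\sum_{s\in S}s\binom{n}{s-1}B_{n-s+1,S,r-1},$$ $$B_{n+1,S,r}=B_{n,S,r+1}+r\sum_{s\in S}\binom{n}{s-2}B_{n-s+2,S,r-1}.$$
   Context: For $S\subseteq\mathbb{Z}^+$ and integers $n,k,r\ge 0$, ${n\brace k}_{S,r}$ is the number of set partitions of $[n+r]$ into $k+r$ non-empty blocks such that $1,\dots,r$ lie in distinct blocks and every block has cardinality in $S$. The $(S,r)$-Bell number is $B_{n,S,r}=\sum_{k=0}^n{n\brace k}_{S,r}$, the number of all such partitions of $[n+r]$. Conventions: $\binom{n}{m}=0$ if $m<0$ or $m>n$, so terms with a negative subscript $n-s+\cdot$ do not occur; when $r=0$ terms carrying the factor $r$ are $0$. -}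

module Defs where

open import Data.Nat using (ℕ; zero; suc; _+_; _*_; _∸_; _≡ᵇ_; _<ᵇ_)
open import Data.Bool using (Bool; true; false; _∧_; _∨_; not; if_then_else_)
open import Data.Fin using (Fin; toℕ)
open import Data.List using (List; []; _∷_; [_]; map; concatMap; length; filterᵇ; upTo; allFin)
open import Data.Bool.ListAction using (all)
open import Data.Nat.ListAction using (sum)

Subsetℕ : Set
Subsetℕ = ℕ → Bool

allFuns : {A : Set} → List A → (m : ℕ) → List (Fin m → A)
allFuns xs zero    = [ (λ ()) ]
allFuns xs (suc m) = concatMap (λ a → map (λ f → cons a f) (allFuns xs m)) xs
  where
  cons : {A : Set} {k : ℕ} → A → (Fin k → A) → Fin (suc k) → A
  cons a f Fin.zero    = a
  cons a f (Fin.suc i) = f i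

Rel₂ : ℕ → Set
Rel₂ m = Fin m → Fin m → Bool

allRels : (m : ℕ) → List (Rel₂ m)
allRels m = allFuns (allFuns (true ∷ false ∷ []) m) m

_⇒ᵇ_ : Bool → Bool → Bool
a ⇒ᵇ b = not a ∨ b

isEquivᵇ : {m : ℕ} → Rel₂ m → Bool
isEquivᵇ {m} R =
  all (λ i → R i i) (allFin m) ∧
  all (λ i → all (λ j → R i j ⇒ᵇ R j i) (allFin m)) (allFin m) ∧
  all (λ i → all (λ j → all (λ k → (R i j ∧ R j k) ⇒ᵇ R i k) (allFin m)) (allFin m)) (allFin m)

blockSize : {m : ℕ} → Rel₂ m → Fin m → ℕ
blockSize {m} R i = length (filterᵇ (R i) (allFin m))

-- Set partitions of [n+r] (= Fin (n + r), element i ↔ i+1) are identified with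
-- equivalence relations on Fin (n + r) (blocks = classes).  Admissible: every block
-- has cardinality in S, and the elements 1..r (indices < r) lie in distinct blocks.
admissibleᵇ : Subsetℕ → (n r : ℕ) → Rel₂ (n + r) → Bool
admissibleᵇ S n r R =
  isEquivᵇ R ∧
  all (λ i → S (blockSize R i)) (allFin (n + r)) ∧
  all (λ i → all (λ j → ((toℕ i <ᵇ r) ∧ (toℕ j <ᵇ r) ∧ not (toℕ i ≡ᵇ toℕ j)) ⇒ᵇ not (R i j))
                 (allFin (n + r))) (allFin (n + r))

-- (S,r)-Bell number B_{n,S,r}: number of all such partitions of [n+r]
-- (= Σ_k {n brace k}_{S,r}, since such a partition always has between r and n+r blocks).
B : Subsetℕ → (n r : ℕ) → ℕ
B S n r = length (filterᵇ (admissibleᵇ S n r) (allRels (n + r)))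

ΣS : Subsetℕ → (a b : ℕ) → (ℕ → ℕ) → ℕ
ΣS S a b f = sum (map (λ s → if S s then f s else 0) (map (a +_) (upTo (suc b ∸ a))))

module Submission where

-- The three identities all come from one "block of a chosen point" recursion.
--
-- We generalise B to bell U Sp: the number of admissible partitions of an arbitrary
-- ground set U ⊆ Fin M in which the points of Sp ⊆ U ("special" points) lie in distinct
-- blocks.  Fix e ∈ U.  Deleting the block Tb of e is a bijection between admissible
-- partitions of U with that block and admissible partitions of U ∖ Tb with special
-- points Sp ∖ Tb; Tb ranges over the sets containing e, inside U, of size in S and with
-- at most one special point.  By strong induction on ∣U∣ this shows that bell U Sp only
-- depends on the numbers N of ordinary and R of special points, so it equals B S N R,
-- and that B S N R is a sum over the possible blocks of e.  Grouping these blocks by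
-- their numbers of special and ordinary points gives a binomial double sum.  Taking e
-- special gives the first identity, taking e ordinary the third, and the second follows
-- from both by the absorption identity (k+1)·C(n+1,k+1) = (n+1)·C(n,k).

open import Defs
open import Data.Nat using (ℕ; zero; suc; _+_; _*_; _∸_; _≡ᵇ_; _<ᵇ_; _≤ᵇ_; _≤_; _<_; z≤n; s≤s; s≤s⁻¹)
open import Data.Nat.Properties
open import Data.Nat.Combinatorics using (_C_; nCk+nC[k+1]≡[n+1]C[k+1]; k>n⇒nCk≡0; nC1≡n)
open import Data.Nat.ListAction using (sum)
open import Data.Nat.Solver using (module +-*-Solver)
open import Data.Bool using (Bool; true; false; _∧_; _∨_; not; if_then_else_; T)
open import Data.Bool.Properties using (∧-comm)
open import Data.Bool.ListAction using (all)
open import Data.Fin using (Fin; toℕ; fromℕ<) renaming (zero to fzero; suc to fsuc)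
open import Data.Fin.Properties using (toℕ-injective; toℕ-fromℕ<)
  renaming (0≢1+n to fzero≢fsuc; suc-injective to fsuc-injective)
open import Data.List using (List; []; _∷_; map; concatMap; length; filterᵇ; allFin; _++_; tabulate; applyUpTo)
open import Data.Unit using (tt)
open import Data.Empty using (⊥; ⊥-elim)
open import Data.Sum using (_⊎_; inj₁; inj₂)
open import Data.Product using (_×_; _,_; proj₁; proj₂; Σ)
open import Function using (id)
open import Algebra.Properties.CommutativeSemigroup +-commutativeSemigroup using (interchange)
open import Algebra.Properties.CommutativeSemigroup *-commutativeSemigroup using (x∙yz≈y∙xz)
open import Relation.Binary.PropositionalEquality
open ≡-Reasoning

𝟙 : Bool → ℕ
𝟙 true  = 1
𝟙 false = 0

𝟙-∧ : ∀ a b → 𝟙 (a ∧ b) ≡ 𝟙 a * 𝟙 b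
𝟙-∧ true  b = sym (+-identityʳ (𝟙 b))
𝟙-∧ false b = refl

𝟙-split : ∀ a b → 𝟙 a ≡ 𝟙 (a ∧ b) + 𝟙 (a ∧ not b)
𝟙-split true  true  = refl
𝟙-split true  false = refl
𝟙-split false b     = refl

𝟙-*-if : ∀ c n → 𝟙 c * n ≡ (if c then n else 0)
𝟙-*-if true  n = +-identityʳ n
𝟙-*-if false n = refl

𝟙-vanish : ∀ {c} m n → c ≡ false → 𝟙 c * m ≡ 𝟙 c * n
𝟙-vanish m n refl = refl

∧-intro : ∀ {a b} → T a → T b → T (a ∧ b)
∧-intro {true} _ y = y

∧-fst : ∀ {a b} → T (a ∧ b) → T a
∧-fst {true} _ = tt

∧-snd : ∀ {a b} → T (a ∧ b) → T b
∧-snd {true} y = y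

∨-inl : ∀ {a b} → T a → T (a ∨ b)
∨-inl {true} _ = tt

∨-inr : ∀ {a b} → T b → T (a ∨ b)
∨-inr {true}  _ = tt
∨-inr {false} y = y

∨-elim : ∀ {a b} {C : Set} → T (a ∨ b) → (T a → C) → (T b → C) → C
∨-elim {true}  _ f _ = f tt
∨-elim {false} y _ g = g y

⇒-intro : ∀ {a b} → (T a → T b) → T (a ⇒ᵇ b)
⇒-intro {true}  h = h tt
⇒-intro {false} _ = tt

⇒-elim : ∀ {a b} → T (a ⇒ᵇ b) → T a → T b
⇒-elim {true} h _ = h

not-intro : ∀ {a} → (T a → ⊥) → T (not a)
not-intro {true}  h = h tt
not-intro {false} _ = tt

not-elim : ∀ {a} → T (not a) → T a → ⊥
not-elim {false} _ ()

T-dec : ∀ b → T b ⊎ (T b → ⊥)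
T-dec true  = inj₁ tt
T-dec false = inj₂ λ ()

T-true : ∀ {a} → T a → a ≡ true
T-true {true} _ = refl

T-false : ∀ {a} → (T a → ⊥) → a ≡ false
T-false {true}  h = ⊥-elim (h tt)
T-false {false} _ = refl

T-ext : ∀ {a b} → (T a → T b) → (T b → T a) → a ≡ b
T-ext {true}  f _ = sym (T-true (f tt))
T-ext {false} _ g = sym (T-false g)

sumL : {X : Set} → (X → ℕ) → List X → ℕ
sumL f []       = 0
sumL f (x ∷ xs) = f x + sumL f xs

count : {X : Set} → (X → Bool) → List X → ℕ
count P = sumL (λ x → 𝟙 (P x))

module _ {X : Set} where

  sumL-cong : {f g : X → ℕ} → (∀ x → f x ≡ g x) → ∀ xs → sumL f xs ≡ sumL g xs
  sumL-cong h []       = refl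
  sumL-cong h (x ∷ xs) = cong₂ _+_ (h x) (sumL-cong h xs)

  sumL-++ : (f : X → ℕ) (xs ys : List X) → sumL f (xs ++ ys) ≡ sumL f xs + sumL f ys
  sumL-++ f []       ys = refl
  sumL-++ f (x ∷ xs) ys = trans (cong (f x +_) (sumL-++ f xs ys)) (sym (+-assoc (f x) _ _))

  sumL-+ : (f g : X → ℕ) (xs : List X) → sumL (λ x → f x + g x) xs ≡ sumL f xs + sumL g xs
  sumL-+ f g []       = refl
  sumL-+ f g (x ∷ xs) = trans (cong (f x + g x +_) (sumL-+ f g xs)) (interchange (f x) (g x) _ _)

  sumL-zero : (xs : List X) → sumL (λ _ → 0) xs ≡ 0
  sumL-zero []       = refl
  sumL-zero (x ∷ xs) = sumL-zero xs

  sumL-*ˡ : (c : ℕ) (f : X → ℕ) (xs : List X) → sumL (λ x → c * f x) xs ≡ c * sumL f xs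
  sumL-*ˡ c f []       = sym (*-zeroʳ c)
  sumL-*ˡ c f (x ∷ xs) = trans (cong (c * f x +_) (sumL-*ˡ c f xs)) (sym (*-distribˡ-+ c (f x) _))

  count-cong : {P Q : X → Bool} → (∀ x → P x ≡ Q x) → ∀ xs → count P xs ≡ count Q xs
  count-cong h = sumL-cong (λ x → cong 𝟙 (h x))

  length-filterᵇ : (P : X → Bool) (xs : List X) → length (filterᵇ P xs) ≡ count P xs
  length-filterᵇ P []       = refl
  length-filterᵇ P (x ∷ xs) with P x
  ... | true  = cong suc (length-filterᵇ P xs)
  ... | false = length-filterᵇ P xs

sumL-map : {X Y : Set} (f : Y → ℕ) (g : X → Y) (xs : List X) →
           sumL f (map g xs) ≡ sumL (λ x → f (g x)) xs
sumL-map f g []       = refl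
sumL-map f g (x ∷ xs) = cong (f (g x) +_) (sumL-map f g xs)

sumL-concatMap : {X Y : Set} (f : Y → ℕ) (g : X → List Y) (xs : List X) →
                 sumL f (concatMap g xs) ≡ sumL (λ x → sumL f (g x)) xs
sumL-concatMap f g []       = refl
sumL-concatMap f g (x ∷ xs) =
  trans (sumL-++ f (g x) (concatMap g xs)) (cong (sumL f (g x) +_) (sumL-concatMap f g xs))

sumL-swap : {X Y : Set} (h : X → Y → ℕ) (xs : List X) (ys : List Y) →
            sumL (λ x → sumL (h x) ys) xs ≡ sumL (λ y → sumL (λ x → h x y) xs) ys
sumL-swap h []       ys = sym (sumL-zero ys)
sumL-swap h (x ∷ xs) ys =
  trans (cong (sumL (h x) ys +_) (sumL-swap h xs ys)) (sym (sumL-+ (h x) _ ys))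

record Enumerates {X : Set} (eq : X → X → Bool) (xs : List X) : Set where
  field occursOnce : ∀ y → count (λ x → eq x y) xs ≡ 1
open Enumerates

module _ {X : Set} {eq : X → X → Bool} {xs : List X} (enum : Enumerates eq xs) where

  count-point : ∀ Q x₀ → count (λ x → Q ∧ eq x x₀) xs ≡ 𝟙 Q
  count-point Q x₀ = begin
    count (λ x → Q ∧ eq x x₀) xs         ≡⟨ sumL-cong (λ x → 𝟙-∧ Q (eq x x₀)) xs ⟩
    sumL (λ x → 𝟙 Q * 𝟙 (eq x x₀)) xs    ≡⟨ sumL-*ˡ (𝟙 Q) _ xs ⟩
    𝟙 Q * count (λ x → eq x x₀) xs       ≡⟨ cong (𝟙 Q *_) (occursOnce enum x₀) ⟩
    𝟙 Q * 1                              ≡⟨ *-identityʳ (𝟙 Q) ⟩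
    𝟙 Q                                  ∎

  count-by-fibres : {Z : Set} (P : Z → Bool) (h : Z → X) (zs : List Z) →
                    count P zs ≡ sumL (λ y → count (λ z → P z ∧ eq y (h z)) zs) xs
  count-by-fibres P h zs = begin
    count P zs
      ≡⟨ sumL-cong (λ z → sym (count-point (P z) (h z))) zs ⟩
    sumL (λ z → count (λ y → P z ∧ eq y (h z)) xs) zs
      ≡⟨ sumL-swap _ zs xs ⟩
    sumL (λ y → count (λ z → P z ∧ eq y (h z)) zs) xs ∎

double-count : {X Y : Set} {eqX : X → X → Bool} {eqY : Y → Y → Bool} {xs : List X} {ys : List Y} →
  Enumerates eqX xs → Enumerates eqY ys → (P : X → Bool) (Q : Y → Bool) (f : X → Y) (g : Y → X) →
  (∀ x y → (P x ∧ eqY y (f x)) ≡ (Q y ∧ eqX x (g y))) → count P xs ≡ count Q ys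
double-count {xs = xs} {ys} enumX enumY P Q f g inverse = begin
  count P xs
    ≡⟨ count-by-fibres enumY P f xs ⟩
  sumL (λ y → count (λ x → P x ∧ _ ) xs) ys
    ≡⟨ sumL-cong (λ y → count-cong (λ x → inverse x y) xs) ys ⟩
  sumL (λ y → count (λ x → Q y ∧ _) xs) ys
    ≡⟨ sumL-cong (λ y → count-point enumX (Q y) (g y)) ys ⟩
  count Q ys ∎

eqFun : {A : Set} → (A → A → Bool) → {m : ℕ} → (Fin m → A) → (Fin m → A) → Bool
eqFun eqA {zero}  f g = true
eqFun eqA {suc m} f g = eqA (f fzero) (g fzero) ∧ eqFun eqA (λ i → f (fsuc i)) (λ i → g (fsuc i))

sum-allFuns-suc : {A : Set} (xs : List A) (m : ℕ) (G : A → (Fin m → A) → ℕ) →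
  sumL (λ h → G (h fzero) (λ i → h (fsuc i))) (allFuns xs (suc m)) ≡ sumL (λ a → sumL (G a) (allFuns xs m)) xs
sum-allFuns-suc xs m G =
  trans (sumL-concatMap _ _ xs) (sumL-cong (λ a → sumL-map _ _ (allFuns xs m)) xs)

module _ {A : Set} {eqA : A → A → Bool} where

  allFuns-enumerates : {xs : List A} → Enumerates eqA xs → ∀ m → Enumerates (eqFun eqA {m}) (allFuns xs m)
  allFuns-enumerates enum zero    .occursOnce g = refl
  allFuns-enumerates {xs} enum (suc m) .occursOnce g = begin
    count (λ h → eqFun eqA h g) (allFuns xs (suc m))
      ≡⟨ sum-allFuns-suc xs m (λ a f → 𝟙 (eqA a (g fzero) ∧ eqFun eqA f g′)) ⟩
    sumL (λ a → count (λ f → eqA a (g fzero) ∧ eqFun eqA f g′) (allFuns xs m)) xs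
      ≡⟨ sumL-cong (λ a → count-point (allFuns-enumerates enum m) (eqA a (g fzero)) g′) xs ⟩
    count (λ a → eqA a (g fzero)) xs
      ≡⟨ occursOnce enum (g fzero) ⟩
    1 ∎
    where
    g′ : Fin m → A
    g′ i = g (fsuc i)

  module _ {_≈_ : A → A → Set} where
    eqFun-sound : (∀ {a b} → T (eqA a b) → a ≈ b) →
                  ∀ {m} {f g : Fin m → A} → T (eqFun eqA f g) → ∀ i → f i ≈ g i
    eqFun-sound sound {suc m} h fzero    = sound (∧-fst h)
    eqFun-sound sound {suc m} {f} {g} h (fsuc i) =
      eqFun-sound sound {m} {λ k → f (fsuc k)} {λ k → g (fsuc k)} (∧-snd {eqA (f fzero) (g fzero)} h) i

    eqFun-complete : (∀ {a b} → a ≈ b → T (eqA a b)) →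
                     ∀ {m} {f g : Fin m → A} → (∀ i → f i ≈ g i) → T (eqFun eqA f g)
    eqFun-complete complete {zero}  h = tt
    eqFun-complete complete {suc m} h = ∧-intro (complete (h fzero)) (eqFun-complete complete (λ i → h (fsuc i)))

eqB : Bool → Bool → Bool
eqB true  true  = true
eqB false false = true
eqB _     _     = false

eqB-sound : ∀ {a b} → T (eqB a b) → a ≡ b
eqB-sound {true}  {true}  _ = refl
eqB-sound {false} {false} _ = refl

eqB-complete : ∀ {a b} → a ≡ b → T (eqB a b)
eqB-complete {true}  refl = tt
eqB-complete {false} refl = tt

bools-enumerate : Enumerates eqB (true ∷ false ∷ [])
bools-enumerate .occursOnce true  = refl
bools-enumerate .occursOnce false = refl

Sub : ℕ → Set
Sub M = Fin M → Bool

allSubs : (M : ℕ) → List (Sub M)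
allSubs = allFuns (true ∷ false ∷ [])

eqSub : ∀ {M} → Sub M → Sub M → Bool
eqSub = eqFun eqB

eqRel : ∀ {M} → Rel₂ M → Rel₂ M → Bool
eqRel = eqFun eqSub

allSubs-enumerate : ∀ M → Enumerates (eqSub {M}) (allSubs M)
allSubs-enumerate = allFuns-enumerates bools-enumerate

allRels-enumerate : ∀ M → Enumerates (eqRel {M}) (allRels M)
allRels-enumerate M = allFuns-enumerates (allSubs-enumerate M) M

eqSub-sound : ∀ {M} {X Y : Sub M} → T (eqSub X Y) → X ≗ Y
eqSub-sound = eqFun-sound eqB-sound

eqSub-complete : ∀ {M} {X Y : Sub M} → X ≗ Y → T (eqSub X Y)
eqSub-complete = eqFun-complete eqB-complete

eqRel-sound : ∀ {M} {R R′ : Rel₂ M} → T (eqRel R R′) → ∀ i j → R i j ≡ R′ i j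
eqRel-sound = eqFun-sound {_≈_ = _≗_} eqSub-sound

eqRel-complete : ∀ {M} {R R′ : Rel₂ M} → (∀ i j → R i j ≡ R′ i j) → T (eqRel R R′)
eqRel-complete = eqFun-complete {_≈_ = _≗_} eqSub-complete

-- Boolean equality of points of Fin M (the test used in Defs.admissibleᵇ).
eqFin : ∀ {M} → Fin M → Fin M → Bool
eqFin i j = toℕ i ≡ᵇ toℕ j

eqFin-sound : ∀ {M} {i j : Fin M} → T (eqFin i j) → i ≡ j
eqFin-sound {i = i} {j} h = toℕ-injective (≡ᵇ⇒≡ (toℕ i) (toℕ j) h)

eqFin-complete : ∀ {M} {i j : Fin M} → i ≡ j → T (eqFin i j)
eqFin-complete {i = i} refl = ≡⇒≡ᵇ (toℕ i) (toℕ i) refl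

module _ {M : ℕ} where

  infixl 8 _∩_
  infixl 8 _∖_
  infix 4 _⊆_

  _∩_ : Sub M → Sub M → Sub M
  (X ∩ Y) i = X i ∧ Y i

  _∖_ : Sub M → Sub M → Sub M
  (X ∖ Y) i = X i ∧ not (Y i)

  _⊆_ : Sub M → Sub M → Set
  X ⊆ Y = ∀ i → T (X i) → T (Y i)

  full : Sub M
  full _ = true

  single : Fin M → Sub M
  single e i = eqFin e i

  -- The r smallest points; they play the role of 1, …, r in the paper.
  firstPoints : ℕ → Sub M
  firstPoints r i = toℕ i <ᵇ r

allF : ∀ {M} → (Fin M → Bool) → Bool
allF {zero}  p = true
allF {suc M} p = p fzero ∧ allF (λ i → p (fsuc i))

allF-elim : ∀ {M} {p : Fin M → Bool} → T (allF p) → ∀ i → T (p i)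
allF-elim {suc M} {p} h fzero    = ∧-fst h
allF-elim {suc M} {p} h (fsuc i) = allF-elim {M} (∧-snd {p fzero} h) i

allF-intro : ∀ {M} {p : Fin M → Bool} → (∀ i → T (p i)) → T (allF p)
allF-intro {zero}  h = tt
allF-intro {suc M} h = ∧-intro (h fzero) (allF-intro (λ i → h (fsuc i)))

infix 7 _⊆ᵇ_

_⊆ᵇ_ : ∀ {M} → Sub M → Sub M → Bool
X ⊆ᵇ Y = allF (λ i → X i ⇒ᵇ Y i)

⊆ᵇ-sound : ∀ {M} {X Y : Sub M} → T (X ⊆ᵇ Y) → X ⊆ Y
⊆ᵇ-sound {X = X} {Y} h i = ⇒-elim {X i} (allF-elim h i)

⊆ᵇ-complete : ∀ {M} {X Y : Sub M} → X ⊆ Y → T (X ⊆ᵇ Y)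
⊆ᵇ-complete {X = X} {Y} h = allF-intro (λ i → ⇒-intro {X i} (h i))

∣_∣ : ∀ {M} → Sub M → ℕ
∣_∣ {zero}  X = 0
∣_∣ {suc M} X = 𝟙 (X fzero) + ∣ (λ i → X (fsuc i)) ∣

∣∣-cong : ∀ {M} {X Y : Sub M} → X ≗ Y → ∣ X ∣ ≡ ∣ Y ∣
∣∣-cong {zero}  h = refl
∣∣-cong {suc M} h = cong₂ _+_ (cong 𝟙 (h fzero)) (∣∣-cong (λ i → h (fsuc i)))

∣∣-split : ∀ {M} (X Y : Sub M) → ∣ X ∣ ≡ ∣ X ∩ Y ∣ + ∣ X ∖ Y ∣
∣∣-split {zero}  X Y = refl
∣∣-split {suc M} X Y =
  trans (cong₂ _+_ (𝟙-split (X fzero) (Y fzero)) (∣∣-split (λ i → X (fsuc i)) (λ i → Y (fsuc i))))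
        (interchange (𝟙 (X fzero ∧ Y fzero)) _ _ _)

∣∖∣ : ∀ {M} (X Y : Sub M) → ∣ X ∖ Y ∣ ≡ ∣ X ∣ ∸ ∣ X ∩ Y ∣
∣∖∣ X Y = sym (trans (cong (_∸ ∣ X ∩ Y ∣) (∣∣-split X Y)) (m+n∸m≡n ∣ X ∩ Y ∣ ∣ X ∖ Y ∣))

∣∣-empty : ∀ {M} (X : Sub M) → (∀ i → T (X i) → ⊥) → ∣ X ∣ ≡ 0
∣∣-empty {zero}  X h = refl
∣∣-empty {suc M} X h rewrite T-false (h fzero) = ∣∣-empty (λ i → X (fsuc i)) (λ i → h (fsuc i))

∣∣-zero : ∀ {M} (X : Sub M) → ∣ X ∣ ≡ 0 → ∀ i → T (X i) → ⊥
∣∣-zero {suc M} X h i x with X fzero in x₀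
∣∣-zero {suc M} X h fzero    x | false = subst T x₀ x
∣∣-zero {suc M} X h (fsuc i) x | false = ∣∣-zero (λ i → X (fsuc i)) h i x

∣∣-pos : ∀ {M} (X : Sub M) {n} → ∣ X ∣ ≡ suc n → Σ (Fin M) (λ e → T (X e))
∣∣-pos {suc M} X h with T-dec (X fzero)
... | inj₁ x₀ = fzero , x₀
... | inj₂ ¬x₀ rewrite T-false ¬x₀ = let (e , x) = ∣∣-pos (λ i → X (fsuc i)) h in fsuc e , x

∣∖∣-< : ∀ {M} (X Y : Sub M) e → T (X e) → T (Y e) → ∣ X ∖ Y ∣ < ∣ X ∣
∣∖∣-< X Y e x y = subst (∣ X ∖ Y ∣ <_) (sym (∣∣-split X Y)) (+-monoˡ-≤ ∣ X ∖ Y ∣ (member (X ∩ Y) e (∧-intro x y)))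
  where
  member : ∀ {M} (Z : Sub M) e → T (Z e) → 1 ≤ ∣ Z ∣
  member {suc M} Z fzero    z rewrite T-true z = s≤s z≤n
  member {suc M} Z (fsuc e) z = ≤-trans (member (λ i → Z (fsuc i)) e z) (m≤n+m _ (𝟙 (Z fzero)))

∣single∩∣ : ∀ {M} (e : Fin M) (X : Sub M) → ∣ single e ∩ X ∣ ≡ 𝟙 (X e)
∣single∩∣ {suc M} fzero    X = trans (cong (𝟙 (X fzero) +_) (∣∣-empty {M} (λ _ → false) (λ _ ()))) (+-identityʳ _)
∣single∩∣ {suc M} (fsuc e) X = ∣single∩∣ e (λ i → X (fsuc i))

single-⊆ᵇ : ∀ {M} (e : Fin M) (X : Sub M) → (single e ⊆ᵇ X) ≡ X e
single-⊆ᵇ e X = T-ext (λ h → ⊆ᵇ-sound {X = single e} h e (eqFin-complete {i = e} refl))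
                      (λ x → ⊆ᵇ-complete {X = single e} (λ i s → subst (λ k → T (X k)) (eqFin-sound s) x))

∣∣≤1-intro : ∀ {M} (X : Sub M) → (∀ i j → T (X i) → T (X j) → i ≡ j) → ∣ X ∣ ≤ 1
∣∣≤1-intro {zero}  X h = z≤n
∣∣≤1-intro {suc M} X h with T-dec (X fzero)
... | inj₁ x₀ rewrite T-true x₀ | ∣∣-empty (λ i → X (fsuc i)) (λ i x → fzero≢fsuc (h fzero (fsuc i) x₀ x)) = s≤s z≤n
... | inj₂ ¬x₀ rewrite T-false ¬x₀ = ∣∣≤1-intro (λ i → X (fsuc i)) (λ i j x y → fsuc-injective (h (fsuc i) (fsuc j) x y))

∣∣≤1-elim : ∀ {M} (X : Sub M) → ∣ X ∣ ≤ 1 → ∀ i j → T (X i) → T (X j) → i ≡ j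
∣∣≤1-elim {suc M} X h fzero    fzero    x y = refl
∣∣≤1-elim {suc M} X h fzero    (fsuc j) x y rewrite T-true x = ⊥-elim (∣∣-zero (λ i → X (fsuc i)) (n≤0⇒n≡0 (s≤s⁻¹ h)) j y)
∣∣≤1-elim {suc M} X h (fsuc i) fzero    x y rewrite T-true y = ⊥-elim (∣∣-zero (λ i → X (fsuc i)) (n≤0⇒n≡0 (s≤s⁻¹ h)) i x)
∣∣≤1-elim {suc M} X h (fsuc i) (fsuc j) x y =
  cong fsuc (∣∣≤1-elim (λ i → X (fsuc i)) (≤-trans (m≤n+m _ (𝟙 (X fzero))) h) i j x y)

∣full∣ : ∀ M → ∣ full {M} ∣ ≡ M
∣full∣ zero    = refl
∣full∣ (suc M) = cong suc (∣full∣ M)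

∣firstPoints∣ : ∀ M r → r ≤ M → ∣ firstPoints {M} r ∣ ≡ r
∣firstPoints∣ zero    zero    _       = refl
∣firstPoints∣ (suc M) zero    _       = ∣∣-empty {M} (λ _ → false) (λ _ ())
∣firstPoints∣ (suc M) (suc r) (s≤s h) = cong suc (∣firstPoints∣ M r h)

∧-⊆ : ∀ u s → (T s → T u) → u ∧ s ≡ s
∧-⊆ true  s     _ = refl
∧-⊆ false true  h = sym (T-false (λ _ → h tt))
∧-⊆ false false _ = refl

restrict-⊆ : ∀ u v w → (T w → T u) → (u ∧ not v) ∧ w ≡ w ∧ not v
restrict-⊆ true  v true  _ = ∧-comm (not v) true
restrict-⊆ true  v false _ = ∧-comm (not v) false
restrict-⊆ false v true  h = ⊥-elim (h tt)
restrict-⊆ false v false _ = refl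

∖-swap : ∀ u v w → (u ∧ not v) ∧ not w ≡ (u ∧ not w) ∧ not v
∖-swap true  true  true  = refl
∖-swap true  true  false = refl
∖-swap true  false true  = refl
∖-swap true  false false = refl
∖-swap false v     w     = refl

∖-∖-absorb : ∀ u v w → (u ∧ not v) ∧ not (w ∧ not v) ≡ (u ∧ not v) ∧ not w
∖-∖-absorb true  true  w     = refl
∖-∖-absorb true  false true  = refl
∖-∖-absorb true  false false = refl
∖-∖-absorb false v     w     = refl

split₃ : ∀ {a b c} → T (a ∧ (b ∧ c)) → T a × T b × T c
split₃ {true} {true} h = tt , tt , h

join₃ : ∀ {a b c} → T a → T b → T c → T (a ∧ (b ∧ c))
join₃ x y z = ∧-intro x (∧-intro y z)

split₆ : ∀ {a b c d e f} → T (a ∧ (b ∧ (c ∧ (d ∧ (e ∧ f))))) → T a × T b × T c × T d × T e × T f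
split₆ {true} {true} {true} {true} {true} h = tt , tt , tt , tt , tt , h

join₆ : ∀ {a b c d e f} → T a → T b → T c → T d → T e → T f → T (a ∧ (b ∧ (c ∧ (d ∧ (e ∧ f)))))
join₆ x₁ x₂ x₃ x₄ x₅ x₆ = ∧-intro x₁ (∧-intro x₂ (join₃ x₃ x₄ (∧-intro x₅ x₆)))

all-allFin : ∀ {M} (p : Fin M → Bool) → all p (allFin M) ≡ allF p
all-allFin p = all-tabulate p (λ i → i)
  where
  all-tabulate : ∀ {M} {A : Set} (p : A → Bool) (g : Fin M → A) → all p (tabulate g) ≡ allF (λ i → p (g i))
  all-tabulate {zero}  p g = refl
  all-tabulate {suc M} p g = cong (p (g fzero) ∧_) (all-tabulate p (λ i → g (fsuc i)))

allFin-elim : ∀ {M} {p : Fin M → Bool} → T (all p (allFin M)) → ∀ i → T (p i)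
allFin-elim {p = p} h = allF-elim (subst T (all-allFin p) h)

allFin-intro : ∀ {M} {p : Fin M → Bool} → (∀ i → T (p i)) → T (all p (allFin M))
allFin-intro {p = p} h = subst T (sym (all-allFin p)) (allF-intro h)

blockSize≡∣∣ : ∀ {M} (R : Rel₂ M) (i : Fin M) → blockSize R i ≡ ∣ R i ∣
blockSize≡∣∣ R i = length-tabulate (R i) (λ j → j)
  where
  length-tabulate : ∀ {M} {A : Set} (p : A → Bool) (g : Fin M → A) →
                    length (filterᵇ p (tabulate g)) ≡ ∣ (λ i → p (g i)) ∣
  length-tabulate {zero}  p g = refl
  length-tabulate {suc M} p g with p (g fzero)
  ... | true  = cong suc (length-tabulate p (λ i → g (fsuc i)))
  ... | false = length-tabulate p (λ i → g (fsuc i))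

module Admissibility (S : Subsetℕ) where

  record Admissible {M : ℕ} (U Sp : Sub M) (R : Rel₂ M) : Set where
    field
      support    : ∀ i j → T (R i j) → T (U i) × T (U j)
      reflexive  : ∀ i → T (U i) → T (R i i)
      symmetric  : ∀ i j → T (R i j) → T (R j i)
      transitive : ∀ i j k → T (R i j) → T (R j k) → T (R i k)
      sizesInS   : ∀ i → T (U i) → T (S ∣ R i ∣)
      apart      : ∀ i j → T (Sp i) → T (Sp j) → T (R i j) → i ≡ j

  module _ {M : ℕ} where

    supportᵇ reflexiveᵇ sizesInSᵇ : Sub M → Rel₂ M → Bool
    supportᵇ   U R = allF (λ i → allF (λ j → R i j ⇒ᵇ (U i ∧ U j)))
    reflexiveᵇ U R = allF (λ i → U i ⇒ᵇ R i i)
    sizesInSᵇ  U R = allF (λ i → U i ⇒ᵇ S ∣ R i ∣)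

    symmetricᵇ transitiveᵇ : Rel₂ M → Bool
    symmetricᵇ  R = allF (λ i → allF (λ j → R i j ⇒ᵇ R j i))
    transitiveᵇ R = allF (λ i → allF (λ j → allF (λ k → (R i j ∧ R j k) ⇒ᵇ R i k)))

    apartᵇ : Sub M → Rel₂ M → Bool
    apartᵇ Sp R = allF (λ i → allF (λ j → (Sp i ∧ Sp j) ⇒ᵇ (R i j ⇒ᵇ eqFin i j)))

    isAdmissible : Sub M → Sub M → Rel₂ M → Bool
    isAdmissible U Sp R =
      supportᵇ U R ∧ (reflexiveᵇ U R ∧ (symmetricᵇ R ∧ (transitiveᵇ R ∧ (sizesInSᵇ U R ∧ apartᵇ Sp R))))

    admissible-sound : ∀ {U Sp R} → T (isAdmissible U Sp R) → Admissible U Sp R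
    admissible-sound {U} {Sp} {R} h with split₆ h
    ... | h₁ , h₂ , h₃ , h₄ , h₅ , h₆ = record
      { support    = λ i j r → let u = ⇒-elim {R i j} (at₂ h₁ i j) r in ∧-fst u , ∧-snd {U i} u
      ; reflexive  = λ i → ⇒-elim {U i} (allF-elim h₂ i)
      ; symmetric  = λ i j → ⇒-elim {R i j} (at₂ h₃ i j)
      ; transitive = λ i j k r r′ → ⇒-elim {R i j ∧ R j k} (allF-elim (at₂ h₄ i j) k) (∧-intro r r′)
      ; sizesInS   = λ i → ⇒-elim {U i} (allF-elim h₅ i)
      ; apart      = λ i j s s′ r →
          eqFin-sound (⇒-elim {R i j} (⇒-elim {Sp i ∧ Sp j} (at₂ h₆ i j) (∧-intro s s′)) r) }
      where
      at₂ : ∀ {p : Fin M → Fin M → Bool} → T (allF (λ i → allF (p i))) → ∀ i j → T (p i j)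
      at₂ h i j = allF-elim (allF-elim h i) j

    admissible-complete : ∀ {U Sp R} → Admissible U Sp R → T (isAdmissible U Sp R)
    admissible-complete {U} {Sp} {R} adm = join₆
      (all₂ λ i j → ⇒-intro {R i j} λ r → ∧-intro (proj₁ (support i j r)) (proj₂ (support i j r)))
      (allF-intro λ i → ⇒-intro {U i} (reflexive i))
      (all₂ λ i j → ⇒-intro {R i j} (symmetric i j))
      (all₂ λ i j → allF-intro λ k → ⇒-intro {R i j ∧ R j k} λ r → transitive i j k (∧-fst r) (∧-snd {R i j} r))
      (allF-intro λ i → ⇒-intro {U i} (sizesInS i))
      (all₂ λ i j → ⇒-intro {Sp i ∧ Sp j} λ s → ⇒-intro {R i j} λ r →
         eqFin-complete (apart i j (∧-fst s) (∧-snd {Sp i} s) r))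
      where
      open Admissible adm
      all₂ : ∀ {p : Fin M → Fin M → Bool} → (∀ i j → T (p i j)) → T (allF (λ i → allF (p i)))
      all₂ h = allF-intro λ i → allF-intro (h i)

    admissible-resp : ∀ {U Sp : Sub M} {R R′ : Rel₂ M} → (∀ i j → R i j ≡ R′ i j) → Admissible U Sp R → Admissible U Sp R′
    admissible-resp {U} {Sp} {R} {R′} R≡R′ adm = record
      { support    = λ i j r → support i j (to i j r)
      ; reflexive  = λ i u → from i i (reflexive i u)
      ; symmetric  = λ i j r → from j i (symmetric i j (to i j r))
      ; transitive = λ i j k r r′ → from i k (transitive i j k (to i j r) (to j k r′))
      ; sizesInS   = λ i u → subst (λ n → T (S n)) (∣∣-cong (R≡R′ i)) (sizesInS i u)
      ; apart      = λ i j s s′ r → apart i j s s′ (to i j r) }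
      where
      open Admissible adm
      to : ∀ i j → T (R′ i j) → T (R i j)
      to i j = subst T (sym (R≡R′ i j))
      from : ∀ i j → T (R i j) → T (R′ i j)
      from i j = subst T (R≡R′ i j)

  bell : ∀ {M} → Sub M → Sub M → ℕ
  bell {M} U Sp = count (isAdmissible U Sp) (allRels M)

  admissibleᵇ-sound : ∀ n r {R} → T (admissibleᵇ S n r R) → Admissible full (firstPoints r) R
  admissibleᵇ-sound n r {R} h with split₃ h
  ... | equivalence , sizes , distinct with split₃ equivalence
  ... | reflexivity , symmetry , transitivity = record
    { support    = λ _ _ _ → tt , tt
    ; reflexive  = λ i _ → allFin-elim reflexivity i
    ; symmetric  = λ i j → ⇒-elim {R i j} (allFin-elim (allFin-elim symmetry i) j)
    ; transitive = λ i j k r r′ →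
        ⇒-elim {R i j ∧ R j k} (allFin-elim (allFin-elim (allFin-elim transitivity i) j) k) (∧-intro r r′)
    ; sizesInS   = λ i _ → subst (λ z → T (S z)) (blockSize≡∣∣ R i) (allFin-elim sizes i)
    ; apart      = λ i j s s′ Rij → separate i j s s′ Rij (T-dec (eqFin i j)) }
    where
    separate : ∀ i j → T (firstPoints r i) → T (firstPoints r j) → T (R i j) →
               T (eqFin i j) ⊎ (T (eqFin i j) → ⊥) → i ≡ j
    separate i j s s′ Rij (inj₁ i≡j) = eqFin-sound i≡j
    separate i j s s′ Rij (inj₂ i≢j) = ⊥-elim (not-elim
      (⇒-elim {(toℕ i <ᵇ r) ∧ ((toℕ j <ᵇ r) ∧ not (eqFin i j))} (allFin-elim (allFin-elim distinct i) j)
              (join₃ s s′ (not-intro i≢j))) Rij)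

  admissibleᵇ-complete : ∀ n r {R} → Admissible full (firstPoints r) R → T (admissibleᵇ S n r R)
  admissibleᵇ-complete n r {R} adm = join₃
    (join₃ (allFin-intro λ i → reflexive i tt)
           (allFin-intro λ i → allFin-intro λ j → ⇒-intro {R i j} (symmetric i j))
           (allFin-intro λ i → allFin-intro λ j → allFin-intro λ k →
              ⇒-intro {R i j ∧ R j k} λ r → transitive i j k (∧-fst r) (∧-snd {R i j} r)))
    (allFin-intro λ i → subst (λ z → T (S z)) (sym (blockSize≡∣∣ R i)) (sizesInS i tt))
    (allFin-intro λ i → allFin-intro λ j → ⇒-intro {(toℕ i <ᵇ r) ∧ ((toℕ j <ᵇ r) ∧ not (eqFin i j))} λ h →
       let (s , s′ , i≢j) = split₃ h in
       not-intro λ Rij → not-elim i≢j (eqFin-complete (apart i j s s′ Rij)))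
    where open Admissible adm

  B≡bell : ∀ n r → B S n r ≡ bell {n + r} full (firstPoints r)
  B≡bell n r = trans (length-filterᵇ _ (allRels (n + r))) (count-cong
    (λ R → T-ext (λ h → admissible-complete (admissibleᵇ-sound n r h)) (λ h → admissibleᵇ-complete n r (admissible-sound h)))
    (allRels (n + r)))

  bell-empty : ∀ {M} (U Sp : Sub M) → ∣ U ∣ ≡ 0 → bell U Sp ≡ 1
  bell-empty {M} U Sp ∣U∣≡0 =
    trans (count-cong (λ R → T-ext (to R) (from R)) (allRels M))
          (occursOnce (allRels-enumerate M) (λ _ _ → false))
    where
    U-empty : ∀ i → T (U i) → ⊥
    U-empty = ∣∣-zero U ∣U∣≡0
    to : ∀ R → T (isAdmissible U Sp R) → T (eqRel R (λ _ _ → false))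
    to R h = eqRel-complete λ i j → T-false λ r →
      U-empty i (proj₁ (Admissible.support (admissible-sound {U = U} {Sp} h) i j r))
    from : ∀ R → T (eqRel R (λ _ _ → false)) → T (isAdmissible U Sp R)
    from R h = admissible-complete {U = U} {Sp} record
      { support    = λ i j r → ⊥-elim (no-pair i j r)
      ; reflexive  = λ i u → ⊥-elim (U-empty i u)
      ; symmetric  = λ i j r → ⊥-elim (no-pair i j r)
      ; transitive = λ i j k r _ → ⊥-elim (no-pair i j r)
      ; sizesInS   = λ i u → ⊥-elim (U-empty i u)
      ; apart      = λ i j _ _ r → ⊥-elim (no-pair i j r) }
      where
      no-pair : ∀ i j → T (R i j) → ⊥
      no-pair i j = subst T (eqRel-sound h i j)

-- An admissible partition R of U is the
-- same as its block Tb of e together with an admissible partition of U ∖ Tb (with the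
-- special points Sp ∖ Tb), so bell U Sp is a sum over the possible blocks Tb.
module BlockDecomposition (S : Subsetℕ) {M : ℕ} (U Sp : Sub M) (e : Fin M) where
  open Admissibility S

  record IsBlock (Tb : Sub M) : Set where
    field
      containsPoint    : T (Tb e)
      withinGround     : Tb ⊆ U
      blockSizeInS     : T (S ∣ Tb ∣)
      atMostOneSpecial : ∀ i j → T (Tb i) → T (Sp i) → T (Tb j) → T (Sp j) → i ≡ j

  isBlock : Sub M → Bool
  isBlock Tb = (single e ⊆ᵇ Tb ∧ Tb ⊆ᵇ U) ∧ ((∣ Tb ∩ Sp ∣ ≤ᵇ 1) ∧ S ∣ Tb ∣)

  isBlock-complete : ∀ {Tb} → IsBlock Tb → T (isBlock Tb)
  isBlock-complete {Tb} blk = ∧-intro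
    (∧-intro (subst T (sym (single-⊆ᵇ e Tb)) containsPoint) (⊆ᵇ-complete withinGround))
    (∧-intro (≤⇒≤ᵇ (∣∣≤1-intro (Tb ∩ Sp) λ i j x y →
       atMostOneSpecial i j (∧-fst x) (∧-snd {Tb i} x) (∧-fst y) (∧-snd {Tb j} y))) blockSizeInS)
    where open IsBlock blk

  isBlock-sound : ∀ {Tb} → T (isBlock Tb) → IsBlock Tb
  isBlock-sound {Tb} h = record
    { containsPoint    = subst T (single-⊆ᵇ e Tb) (∧-fst placed)
    ; withinGround     = ⊆ᵇ-sound (∧-snd {single e ⊆ᵇ Tb} placed)
    ; blockSizeInS     = ∧-snd {∣ Tb ∩ Sp ∣ ≤ᵇ 1} shape
    ; atMostOneSpecial = λ i j t s t′ s′ →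
        ∣∣≤1-elim (Tb ∩ Sp) (≤ᵇ⇒≤ ∣ Tb ∩ Sp ∣ 1 (∧-fst shape)) i j (∧-intro t s) (∧-intro t′ s′) }
    where
    placed : T (single e ⊆ᵇ Tb ∧ Tb ⊆ᵇ U)
    placed = ∧-fst h
    shape : T ((∣ Tb ∩ Sp ∣ ≤ᵇ 1) ∧ S ∣ Tb ∣)
    shape = ∧-snd {single e ⊆ᵇ Tb ∧ Tb ⊆ᵇ U} h

  module _ (Tb : Sub M) where

    removeBlock : Rel₂ M → Rel₂ M
    removeBlock R i j = R i j ∧ (not (Tb i) ∧ not (Tb j))

    addBlock : Rel₂ M → Rel₂ M
    addBlock R′ i j = R′ i j ∨ (Tb i ∧ Tb j)

    module RemoveBlock (R : Rel₂ M) {i j : Fin M} where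
      removeBlock-intro : T (R i j) → (T (Tb i) → ⊥) → (T (Tb j) → ⊥) → T (removeBlock R i j)
      removeBlock-intro r ti tj = ∧-intro r (∧-intro (not-intro ti) (not-intro tj))

      removeBlock-rel : T (removeBlock R i j) → T (R i j)
      removeBlock-rel = ∧-fst

      removeBlock-outˡ : T (removeBlock R i j) → T (Tb i) → ⊥
      removeBlock-outˡ h = not-elim (∧-fst (∧-snd {R i j} h))

      removeBlock-outʳ : T (removeBlock R i j) → T (Tb j) → ⊥
      removeBlock-outʳ h = not-elim (∧-snd {not (Tb i)} (∧-snd {R i j} h))

    module BlockOf {R : Rel₂ M} (adm : Admissible U Sp R) (block : ∀ j → R e j ≡ Tb j) where
      open Admissible adm
      open RemoveBlock R

      toBlock : ∀ j → T (Tb j) → T (R e j)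
      toBlock j = subst T (sym (block j))

      fromBlock : ∀ j → T (R e j) → T (Tb j)
      fromBlock j = subst T (block j)

      closed : ∀ i j → T (R i j) → T (Tb i) → T (Tb j)
      closed i j r t = fromBlock j (transitive e i j (toBlock i t) r)

      removeBlock-outside : ∀ i → (T (Tb i) → ⊥) → ∀ j → removeBlock R i j ≡ R i j
      removeBlock-outside i ti j =
        T-ext removeBlock-rel (λ r → removeBlock-intro r ti (λ tj → ti (closed j i (symmetric i j r) tj)))

      block-isBlock : T (U e) → IsBlock Tb
      block-isBlock e∈U = record
        { containsPoint    = fromBlock e (reflexive e e∈U)
        ; withinGround     = λ i t → proj₂ (support e i (toBlock i t))
        ; blockSizeInS     = subst (λ n → T (S n)) (∣∣-cong block) (sizesInS e e∈U)
        ; atMostOneSpecial = λ i j t s t′ s′ → apart i j s s′ (transitive i e j (symmetric e i (toBlock i t)) (toBlock j t′)) }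

      remove-admissible : Admissible (U ∖ Tb) (Sp ∖ Tb) (removeBlock R)
      remove-admissible = record
        { support    = λ i j h → ∧-intro (proj₁ (support i j (removeBlock-rel h))) (not-intro (removeBlock-outˡ h))
                               , ∧-intro (proj₂ (support i j (removeBlock-rel h))) (not-intro (removeBlock-outʳ h))
        ; reflexive  = λ i u → removeBlock-intro (reflexive i (∧-fst u)) (not-elim (∧-snd {U i} u)) (not-elim (∧-snd {U i} u))
        ; symmetric  = λ i j h → removeBlock-intro (symmetric i j (removeBlock-rel h)) (removeBlock-outʳ h) (removeBlock-outˡ h)
        ; transitive = λ i j k h h′ →
            removeBlock-intro (transitive i j k (removeBlock-rel h) (removeBlock-rel h′)) (removeBlock-outˡ h) (removeBlock-outʳ h′)
        ; sizesInS   = λ i u → subst (λ n → T (S n)) (sym (∣∣-cong (removeBlock-outside i (not-elim (∧-snd {U i} u)))))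
                                     (sizesInS i (∧-fst u))
        ; apart      = λ i j s s′ h → apart i j (∧-fst s) (∧-fst s′) (removeBlock-rel h) }

      add-remove : ∀ i j → addBlock (removeBlock R) i j ≡ R i j
      add-remove i j = T-ext
        (λ h → ∨-elim h removeBlock-rel λ t → transitive i e j (symmetric e i (toBlock i (∧-fst t))) (toBlock j (∧-snd {Tb i} t)))
        (λ r → restore r (T-dec (Tb i)))
        where
        restore : T (R i j) → T (Tb i) ⊎ (T (Tb i) → ⊥) → T (addBlock (removeBlock R) i j)
        restore r (inj₁ ti) = ∨-inr {removeBlock R i j} (∧-intro ti (closed i j r ti))
        restore r (inj₂ ti) = ∨-inl (subst T (sym (removeBlock-outside i ti j)) r)

    module Extension {R′ : Rel₂ M} (adm : Admissible (U ∖ Tb) (Sp ∖ Tb) R′) where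
      open Admissible adm
      open RemoveBlock (addBlock R′)

      outˡ : ∀ {i j} → T (R′ i j) → T (Tb i) → ⊥
      outˡ {i} {j} r = not-elim (∧-snd {U i} (proj₁ (support i j r)))

      outʳ : ∀ {i j} → T (R′ i j) → T (Tb j) → ⊥
      outʳ {i} {j} r = not-elim (∧-snd {U j} (proj₂ (support i j r)))

      remove-add : ∀ i j → removeBlock (addBlock R′) i j ≡ R′ i j
      remove-add i j = T-ext
        (λ h → ∨-elim (removeBlock-rel h) id λ t → ⊥-elim (removeBlock-outˡ h (∧-fst t)))
        (λ r → removeBlock-intro (∨-inl r) (outˡ r) (outʳ r))

      addBlock-inside : ∀ i → T (Tb i) → ∀ j → addBlock R′ i j ≡ Tb j
      addBlock-inside i ti j = T-ext
        (λ h → ∨-elim h (λ r → ⊥-elim (outˡ r ti)) (∧-snd {Tb i}))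
        (λ tj → ∨-inr {R′ i j} (∧-intro ti tj))

      addBlock-outside : ∀ i → (T (Tb i) → ⊥) → ∀ j → addBlock R′ i j ≡ R′ i j
      addBlock-outside i ti j = T-ext
        (λ h → ∨-elim h id λ t → ⊥-elim (ti (∧-fst t)))
        ∨-inl

      module _ (blk : IsBlock Tb) where
        open IsBlock blk

        add-admissible : Admissible U Sp (addBlock R′)
        add-admissible = record
          { support    = λ i j h → ∨-elim {R′ i j} h
              (λ r → ∧-fst (proj₁ (support i j r)) , ∧-fst (proj₂ (support i j r)))
              (λ t → withinGround i (∧-fst t) , withinGround j (∧-snd {Tb i} t))
          ; reflexive  = λ i u → refl-case i u (T-dec (Tb i))
          ; symmetric  = λ i j h → ∨-elim {R′ i j} h
              (λ r → ∨-inl (symmetric i j r))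
              (λ t → ∨-inr {R′ j i} (∧-intro (∧-snd {Tb i} t) (∧-fst t)))
          ; transitive = λ i j k h h′ → ∨-elim {R′ i j} h
              (λ r → ∨-elim {R′ j k} h′ (λ r′ → ∨-inl (transitive i j k r r′)) (λ t → ⊥-elim (outʳ r (∧-fst t))))
              (λ t → ∨-elim {R′ j k} h′ (λ r′ → ⊥-elim (outˡ r′ (∧-snd {Tb i} t)))
                                        (λ t′ → ∨-inr {R′ i k} (∧-intro (∧-fst t) (∧-snd {Tb j} t′))))
          ; sizesInS   = λ i u → size-case i u (T-dec (Tb i))
          ; apart      = λ i j s s′ h → ∨-elim {R′ i j} h
              (λ r → apart i j (∧-intro s (not-intro (outˡ r))) (∧-intro s′ (not-intro (outʳ r))) r)
              (λ t → atMostOneSpecial i j (∧-fst t) s (∧-snd {Tb i} t) s′) }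
          where
          refl-case : ∀ i → T (U i) → T (Tb i) ⊎ (T (Tb i) → ⊥) → T (addBlock R′ i i)
          refl-case i u (inj₁ ti) = ∨-inr {R′ i i} (∧-intro ti ti)
          refl-case i u (inj₂ ti) = ∨-inl (reflexive i (∧-intro u (not-intro ti)))
          size-case : ∀ i → T (U i) → T (Tb i) ⊎ (T (Tb i) → ⊥) → T (S ∣ addBlock R′ i ∣)
          size-case i u (inj₁ ti) = subst (λ n → T (S n)) (sym (∣∣-cong (addBlock-inside i ti))) blockSizeInS
          size-case i u (inj₂ ti) = subst (λ n → T (S n)) (sym (∣∣-cong (addBlock-outside i ti)))
                                          (sizesInS i (∧-intro u (not-intro ti)))

    removal-inverse : T (isBlock Tb) → ∀ R R′ →
      ((isAdmissible U Sp R ∧ eqSub Tb (R e)) ∧ eqRel R′ (removeBlock R))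
        ≡ (isAdmissible (U ∖ Tb) (Sp ∖ Tb) R′ ∧ eqRel R (addBlock R′))
    removal-inverse blk R R′ = T-ext forth back
      where
      forth : T ((isAdmissible U Sp R ∧ eqSub Tb (R e)) ∧ eqRel R′ (removeBlock R))
            → T (isAdmissible (U ∖ Tb) (Sp ∖ Tb) R′ ∧ eqRel R (addBlock R′))
      forth h = ∧-intro
        (admissible-complete (admissible-resp (λ i j → sym (R′≡ i j)) remove-admissible))
        (eqRel-complete λ i j → trans (sym (add-remove i j)) (cong (λ b → b ∨ (Tb i ∧ Tb j)) (sym (R′≡ i j))))
        where
        given : T (isAdmissible U Sp R ∧ eqSub Tb (R e))
        given = ∧-fst h
        R′≡ : ∀ i j → R′ i j ≡ removeBlock R i j
        R′≡ = eqRel-sound (∧-snd {isAdmissible U Sp R ∧ eqSub Tb (R e)} h)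
        open BlockOf (admissible-sound (∧-fst given)) (λ j → sym (eqSub-sound (∧-snd {isAdmissible U Sp R} given) j))
      back : T (isAdmissible (U ∖ Tb) (Sp ∖ Tb) R′ ∧ eqRel R (addBlock R′))
           → T ((isAdmissible U Sp R ∧ eqSub Tb (R e)) ∧ eqRel R′ (removeBlock R))
      back h = ∧-intro
        (∧-intro (admissible-complete (admissible-resp (λ i j → sym (R≡ i j)) (add-admissible (isBlock-sound blk))))
                 (eqSub-complete λ j → sym (trans (R≡ e j) (addBlock-inside e (IsBlock.containsPoint (isBlock-sound blk)) j))))
        (eqRel-complete λ i j → trans (sym (remove-add i j)) (cong (λ b → b ∧ (not (Tb i) ∧ not (Tb j))) (sym (R≡ i j))))
        where
        R≡ : ∀ i j → R i j ≡ addBlock R′ i j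
        R≡ = eqRel-sound (∧-snd {isAdmissible (U ∖ Tb) (Sp ∖ Tb) R′} h)
        open Extension (admissible-sound (∧-fst h))

  module _ (e∈U : T (U e)) where

    count-with-block : ∀ Tb → count (λ R → isAdmissible U Sp R ∧ eqSub Tb (R e)) (allRels M)
                            ≡ 𝟙 (isBlock Tb) * bell (U ∖ Tb) (Sp ∖ Tb)
    count-with-block Tb with T-dec (isBlock Tb)
    ... | inj₁ blk = begin
      count (λ R → isAdmissible U Sp R ∧ eqSub Tb (R e)) (allRels M)
        ≡⟨ double-count (allRels-enumerate M) (allRels-enumerate M) _ _ (removeBlock Tb) (addBlock Tb)
                        (removal-inverse Tb blk) ⟩
      bell (U ∖ Tb) (Sp ∖ Tb)
        ≡⟨ sym (+-identityʳ _) ⟩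
      1 * bell (U ∖ Tb) (Sp ∖ Tb)
        ≡⟨ cong (λ b → 𝟙 b * bell (U ∖ Tb) (Sp ∖ Tb)) (sym (T-true blk)) ⟩
      𝟙 (isBlock Tb) * bell (U ∖ Tb) (Sp ∖ Tb) ∎
    ... | inj₂ ¬blk = begin
      count (λ R → isAdmissible U Sp R ∧ eqSub Tb (R e)) (allRels M)
        ≡⟨ count-cong (λ R → T-false (impossible R)) (allRels M) ⟩
      sumL (λ _ → 0) (allRels M)
        ≡⟨ sumL-zero (allRels M) ⟩
      0
        ≡⟨ cong (λ b → 𝟙 b * bell (U ∖ Tb) (Sp ∖ Tb)) (sym (T-false ¬blk)) ⟩
      𝟙 (isBlock Tb) * bell (U ∖ Tb) (Sp ∖ Tb) ∎
      where
      impossible : ∀ R → T (isAdmissible U Sp R ∧ eqSub Tb (R e)) → ⊥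
      impossible R h = ¬blk (isBlock-complete (BlockOf.block-isBlock Tb (admissible-sound (∧-fst h))
        (λ j → sym (eqSub-sound (∧-snd {isAdmissible U Sp R} h) j)) e∈U))

    decomposition : bell U Sp ≡ sumL (λ Tb → 𝟙 (isBlock Tb) * bell (U ∖ Tb) (Sp ∖ Tb)) (allSubs M)
    decomposition = begin
      bell U Sp
        ≡⟨ count-by-fibres (allSubs-enumerate M) (isAdmissible U Sp) (λ R → R e) (allRels M) ⟩
      sumL (λ Tb → count (λ R → isAdmissible U Sp R ∧ eqSub Tb (R e)) (allRels M)) (allSubs M)
        ≡⟨ sumL-cong count-with-block (allSubs M) ⟩
      sumL (λ Tb → 𝟙 (isBlock Tb) * bell (U ∖ Tb) (Sp ∖ Tb)) (allSubs M) ∎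

-- Binomial sums, defined by Pascal's rule (closed forms are proved later):
-- binomSum l χ = Σ_b C(l,b) χ(b) and binomSum₂ k l ψ = Σ_{a,b} C(k,a) C(l,b) ψ(a,b).
binomSum : ℕ → (ℕ → ℕ) → ℕ
binomSum zero    χ = χ 0
binomSum (suc l) χ = binomSum l χ + binomSum l (λ b → χ (suc b))

binomSum₂ : ℕ → ℕ → (ℕ → ℕ → ℕ) → ℕ
binomSum₂ zero    l ψ = binomSum l (ψ 0)
binomSum₂ (suc k) l ψ = binomSum₂ k l ψ + binomSum₂ k l (λ a b → ψ (suc a) b)

binomSum-cong : ∀ l {χ χ′ : ℕ → ℕ} → (∀ b → χ b ≡ χ′ b) → binomSum l χ ≡ binomSum l χ′
binomSum-cong zero    h = h 0
binomSum-cong (suc l) h = cong₂ _+_ (binomSum-cong l h) (binomSum-cong l (λ b → h (suc b)))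

binomSum-zero : ∀ l → binomSum l (λ _ → 0) ≡ 0
binomSum-zero zero    = refl
binomSum-zero (suc l) = cong₂ _+_ (binomSum-zero l) (binomSum-zero l)

binomSum₂-cong : ∀ k l {ψ ψ′ : ℕ → ℕ → ℕ} → (∀ a b → ψ a b ≡ ψ′ a b) → binomSum₂ k l ψ ≡ binomSum₂ k l ψ′
binomSum₂-cong zero    l h = binomSum-cong l (h 0)
binomSum₂-cong (suc k) l h = cong₂ _+_ (binomSum₂-cong k l h) (binomSum₂-cong k l (λ a b → h (suc a) b))

binomSum₂-sucʳ : ∀ k l ψ → binomSum₂ k (suc l) ψ ≡ binomSum₂ k l ψ + binomSum₂ k l (λ a b → ψ a (suc b))
binomSum₂-sucʳ zero    l ψ = refl
binomSum₂-sucʳ (suc k) l ψ =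
  trans (cong₂ _+_ (binomSum₂-sucʳ k l ψ) (binomSum₂-sucʳ k l (λ a b → ψ (suc a) b)))
        (interchange (binomSum₂ k l ψ) _ _ _)

binomSum₂-atMostOne : ∀ k l ψ → (∀ a b → ψ (suc (suc a)) b ≡ 0) →
                      binomSum₂ k l ψ ≡ binomSum l (ψ 0) + k * binomSum l (ψ 1)
binomSum₂-atMostOne zero    l ψ vanish = sym (+-identityʳ _)
binomSum₂-atMostOne (suc k) l ψ vanish = begin
  binomSum₂ k l ψ + binomSum₂ k l (λ a b → ψ (suc a) b)
    ≡⟨ cong₂ _+_ (binomSum₂-atMostOne k l ψ vanish)
                 (binomSum₂-atMostOne k l (λ a b → ψ (suc a) b) (λ a → vanish (suc a))) ⟩
  (s₀ + k * s₁) + (s₁ + k * binomSum l (ψ 2))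
    ≡⟨ cong (λ z → (s₀ + k * s₁) + (s₁ + k * z)) (trans (binomSum-cong l (vanish 0)) (binomSum-zero l)) ⟩
  (s₀ + k * s₁) + (s₁ + k * 0)
    ≡⟨ cong (λ z → (s₀ + k * s₁) + z) (trans (cong (s₁ +_) (*-zeroʳ k)) (+-identityʳ s₁)) ⟩
  (s₀ + k * s₁) + s₁
    ≡⟨ trans (+-assoc s₀ (k * s₁) s₁) (cong (s₀ +_) (+-comm (k * s₁) s₁)) ⟩
  s₀ + suc k * s₁ ∎
  where
  s₀ = binomSum l (ψ 0)
  s₁ = binomSum l (ψ 1)

subsetSum : ∀ {M} (E U A : Sub M) (ψ : ℕ → ℕ → ℕ) → ℕ
subsetSum {M} E U A ψ = sumL (λ X → 𝟙 (E ⊆ᵇ X ∧ X ⊆ᵇ U) * ψ ∣ X ∩ A ∣ ∣ X ∖ A ∣) (allSubs M)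

module SubsetSumStep {M : ℕ} (E′ U′ A′ : Sub M) (ψ : ℕ → ℕ → ℕ)
  (tail-sum : ∀ ψ′ → subsetSum E′ U′ A′ ψ′
                     ≡ binomSum₂ ∣ (U′ ∖ E′) ∩ A′ ∣ ∣ (U′ ∖ E′) ∖ A′ ∣ (λ a b → ψ′ (∣ E′ ∩ A′ ∣ + a) (∣ E′ ∖ A′ ∣ + b)))
  where

  k l c d : ℕ
  k = ∣ (U′ ∖ E′) ∩ A′ ∣
  l = ∣ (U′ ∖ E′) ∖ A′ ∣
  c = ∣ E′ ∩ A′ ∣
  d = ∣ E′ ∖ A′ ∣

  term : Bool → Bool → Bool → Bool → Sub M → ℕ
  term e₀ u₀ a₀ x X′ = 𝟙 (((e₀ ⇒ᵇ x) ∧ E′ ⊆ᵇ X′) ∧ ((x ⇒ᵇ u₀) ∧ X′ ⊆ᵇ U′))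
                       * ψ (𝟙 (x ∧ a₀) + ∣ X′ ∩ A′ ∣) (𝟙 (x ∧ not a₀) + ∣ X′ ∖ A′ ∣)

  rest : Bool → Bool → Bool → Bool → ℕ
  rest e₀ u₀ a₀ x = sumL (term e₀ u₀ a₀ x) (allSubs M)

  -- The first point is forced out of X (x ⇒ᵇ u₀ fails), killing every term.
  excluded : ∀ (p : Sub M → Bool) (f : Sub M → ℕ) → sumL (λ X → 𝟙 (p X ∧ false) * f X) (allSubs M) ≡ 0
  excluded p f = trans (sumL-cong (λ X → killed (p X) (f X)) (allSubs M)) (sumL-zero (allSubs M))
    where
    killed : ∀ a n → 𝟙 (a ∧ false) * n ≡ 0
    killed true  n = refl
    killed false n = refl

  swap-+0 : ∀ x y → x + (y + 0) ≡ y + x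
  swap-+0 x y = trans (cong (x +_) (+-identityʳ y)) (+-comm x y)

  first-point : ∀ e₀ u₀ a₀ → (T e₀ → T u₀) →
    rest e₀ u₀ a₀ true + (rest e₀ u₀ a₀ false + 0)
      ≡ binomSum₂ (𝟙 ((u₀ ∧ not e₀) ∧ a₀) + k) (𝟙 ((u₀ ∧ not e₀) ∧ not a₀) + l)
                  (λ a b → ψ ((𝟙 (e₀ ∧ a₀) + c) + a) ((𝟙 (e₀ ∧ not a₀) + d) + b))
  -- A point of E lies in X and shifts one of the two sizes.
  first-point true  true  a₀    _ = begin
    rest true true a₀ true + (rest true true a₀ false + 0)
      ≡⟨ cong₂ _+_ (tail-sum (λ a b → ψ (𝟙 a₀ + a) (𝟙 (not a₀) + b))) (cong (_+ 0) (sumL-zero (allSubs M))) ⟩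
    binomSum₂ k l (λ a b → ψ (𝟙 a₀ + (c + a)) (𝟙 (not a₀) + (d + b))) + 0
      ≡⟨ trans (+-identityʳ _) (binomSum₂-cong k l λ a b →
           cong₂ ψ (sym (+-assoc (𝟙 a₀) c a)) (sym (+-assoc (𝟙 (not a₀)) d b))) ⟩
    binomSum₂ k l (λ a b → ψ ((𝟙 a₀ + c) + a) ((𝟙 (not a₀) + d) + b)) ∎
  first-point true  false a₀    h = ⊥-elim (h _)
  -- A free point of A may or may not lie in X.
  first-point false true  true  _ = begin
    rest false true true true + (rest false true true false + 0)
      ≡⟨ cong₂ _+_ (tail-sum (λ a b → ψ (suc a) b)) (cong (_+ 0) (tail-sum ψ)) ⟩
    binomSum₂ k l (λ a b → ψ (suc (c + a)) (d + b)) + (binomSum₂ k l (λ a b → ψ (c + a) (d + b)) + 0)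
      ≡⟨ swap-+0 (binomSum₂ k l (λ a b → ψ (suc (c + a)) (d + b))) _ ⟩
    binomSum₂ k l (λ a b → ψ (c + a) (d + b)) + binomSum₂ k l (λ a b → ψ (suc (c + a)) (d + b))
      ≡⟨ cong (binomSum₂ k l (λ a b → ψ (c + a) (d + b)) +_)
              (binomSum₂-cong k l λ a b → cong (λ z → ψ z (d + b)) (sym (+-suc c a))) ⟩
    binomSum₂ (suc k) l (λ a b → ψ (c + a) (d + b)) ∎
  -- A free point outside A may or may not lie in X.
  first-point false true  false _ = begin
    rest false true false true + (rest false true false false + 0)
      ≡⟨ cong₂ _+_ (tail-sum (λ a b → ψ a (suc b))) (cong (_+ 0) (tail-sum ψ)) ⟩
    binomSum₂ k l (λ a b → ψ (c + a) (suc (d + b))) + (binomSum₂ k l (λ a b → ψ (c + a) (d + b)) + 0)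
      ≡⟨ swap-+0 (binomSum₂ k l (λ a b → ψ (c + a) (suc (d + b)))) _ ⟩
    binomSum₂ k l (λ a b → ψ (c + a) (d + b)) + binomSum₂ k l (λ a b → ψ (c + a) (suc (d + b)))
      ≡⟨ cong (binomSum₂ k l (λ a b → ψ (c + a) (d + b)) +_)
              (binomSum₂-cong k l λ a b → cong (ψ (c + a)) (sym (+-suc d b))) ⟩
    binomSum₂ k l (λ a b → ψ (c + a) (d + b)) + binomSum₂ k l (λ a b → ψ (c + a) (d + suc b))
      ≡⟨ sym (binomSum₂-sucʳ k l (λ a b → ψ (c + a) (d + b))) ⟩
    binomSum₂ k (suc l) (λ a b → ψ (c + a) (d + b)) ∎
  -- A point outside U is never in X.
  first-point false false a₀    _ = begin
    rest false false a₀ true + (rest false false a₀ false + 0)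
      ≡⟨ cong₂ _+_ (excluded (λ X → E′ ⊆ᵇ X) _) (trans (+-identityʳ _) (tail-sum ψ)) ⟩
    binomSum₂ k l (λ a b → ψ (c + a) (d + b)) ∎

-- Choosing the free points of X (those of U ∖ E) inside and outside A separately.
subsetSum≡binomSum₂ : ∀ {M} (E U A : Sub M) ψ → E ⊆ U →
  subsetSum E U A ψ ≡ binomSum₂ ∣ (U ∖ E) ∩ A ∣ ∣ (U ∖ E) ∖ A ∣ (λ a b → ψ (∣ E ∩ A ∣ + a) (∣ E ∖ A ∣ + b))
subsetSum≡binomSum₂ {zero}  E U A ψ _ = trans (+-identityʳ _) (+-identityʳ _)
subsetSum≡binomSum₂ {suc M} E U A ψ E⊆U =
  trans (sum-allFuns-suc (true ∷ false ∷ []) M (term (E fzero) (U fzero) (A fzero)))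
        (first-point (E fzero) (U fzero) (A fzero) (E⊆U fzero))
  where
  open SubsetSumStep (λ i → E (fsuc i)) (λ i → U (fsuc i)) (λ i → A (fsuc i)) ψ
                     (λ ψ′ → subsetSum≡binomSum₂ _ _ _ ψ′ (λ i → E⊆U (fsuc i)))

<ᵇ-irrefl : ∀ r → (r <ᵇ r) ≡ false
<ᵇ-irrefl zero    = refl
<ᵇ-irrefl (suc r) = <ᵇ-irrefl r

∣∣-⊆ : ∀ {M} (U Sp : Sub M) → Sp ⊆ U → ∣ U ∣ ≡ ∣ U ∖ Sp ∣ + ∣ Sp ∣
∣∣-⊆ U Sp Sp⊆U = trans (∣∣-split U Sp)
  (trans (cong (_+ ∣ U ∖ Sp ∣) (∣∣-cong λ i → ∧-⊆ (U i) (Sp i) (Sp⊆U i))) (+-comm ∣ Sp ∣ _))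

remaining-special : ∀ {M} (U Sp Tb : Sub M) → Sp ⊆ U → ∣ (U ∖ Tb) ∩ Sp ∣ ≡ ∣ Sp ∣ ∸ ∣ Tb ∩ Sp ∣
remaining-special U Sp Tb Sp⊆U = begin
  ∣ (U ∖ Tb) ∩ Sp ∣     ≡⟨ ∣∣-cong (λ i → restrict-⊆ (U i) (Tb i) (Sp i) (Sp⊆U i)) ⟩
  ∣ Sp ∖ Tb ∣           ≡⟨ ∣∖∣ Sp Tb ⟩
  ∣ Sp ∣ ∸ ∣ Sp ∩ Tb ∣  ≡⟨ cong (∣ Sp ∣ ∸_) (∣∣-cong (λ i → ∧-comm (Sp i) (Tb i))) ⟩
  ∣ Sp ∣ ∸ ∣ Tb ∩ Sp ∣  ∎

remaining-ordinary : ∀ {M} (U Sp Tb : Sub M) → Tb ⊆ U → ∣ (U ∖ Tb) ∖ Sp ∣ ≡ ∣ U ∖ Sp ∣ ∸ ∣ Tb ∖ Sp ∣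
remaining-ordinary U Sp Tb Tb⊆U = begin
  ∣ (U ∖ Tb) ∖ Sp ∣               ≡⟨ ∣∣-cong (λ i → ∖-swap (U i) (Tb i) (Sp i)) ⟩
  ∣ (U ∖ Sp) ∖ Tb ∣               ≡⟨ ∣∖∣ (U ∖ Sp) Tb ⟩
  ∣ U ∖ Sp ∣ ∸ ∣ (U ∖ Sp) ∩ Tb ∣  ≡⟨ cong (∣ U ∖ Sp ∣ ∸_) (∣∣-cong (λ i → restrict-⊆ (U i) (Sp i) (Tb i) (Tb⊆U i))) ⟩
  ∣ U ∖ Sp ∣ ∸ ∣ Tb ∖ Sp ∣        ∎

canonical-special : ∀ n r → ∣ firstPoints {n + r} r ∣ ≡ r
canonical-special n r = ∣firstPoints∣ (n + r) r (m≤n+m r n)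

canonical-ordinary : ∀ n r → ∣ full {n + r} ∖ firstPoints r ∣ ≡ n
canonical-ordinary n r = begin
  ∣ full′ ∖ firstPoints r ∣              ≡⟨ ∣∖∣ full′ (firstPoints r) ⟩
  ∣ full′ ∣ ∸ ∣ full′ ∩ firstPoints r ∣  ≡⟨ cong₂ _∸_ (∣full∣ (n + r)) (canonical-special n r) ⟩
  n + r ∸ r                              ≡⟨ m+n∸n≡m n r ⟩
  n                                      ∎
  where
  full′ : Sub (n + r)
  full′ = full

module BellRecursion (S : Subsetℕ) where
  open Admissibility S

  -- Weight of a possible block of the pivot with a special and b ordinary points, in a
  -- configuration with N ordinary and R special points: the rest is counted by B.
  blockWeight : ℕ → ℕ → ℕ → ℕ → ℕ
  blockWeight N R a b = if (a ≤ᵇ 1) ∧ S (a + b) then B S (N ∸ b) (R ∸ a) else 0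

  -- Sum of the weights of all possible blocks of a special (σ = true) or ordinary pivot.
  blockSum : ℕ → ℕ → Bool → ℕ
  blockSum N R σ = binomSum₂ (R ∸ 𝟙 σ) (N ∸ 𝟙 (not σ)) (λ a b → blockWeight N R (𝟙 σ + a) (𝟙 (not σ) + b))

  BellUpTo : ℕ → Set
  BellUpTo f = ∀ {M} (U Sp : Sub M) → ∣ U ∣ ≤ f → Sp ⊆ U → bell U Sp ≡ B S ∣ U ∖ Sp ∣ ∣ Sp ∣

  module Pivot {M : ℕ} (U Sp : Sub M) (e : Fin M) (Sp⊆U : Sp ⊆ U) (e∈U : T (U e))
               {f : ℕ} (ih : BellUpTo f) (small : ∣ U ∣ ≤ suc f) where
    open BlockDecomposition S U Sp e

    N R : ℕ
    N = ∣ U ∖ Sp ∣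
    R = ∣ Sp ∣

    block-term : ∀ Tb → 𝟙 (isBlock Tb) * bell (U ∖ Tb) (Sp ∖ Tb)
                      ≡ 𝟙 (single e ⊆ᵇ Tb ∧ Tb ⊆ᵇ U) * blockWeight N R ∣ Tb ∩ Sp ∣ ∣ Tb ∖ Sp ∣
    block-term Tb = begin
      𝟙 (placed ∧ shape) * rest     ≡⟨ cong (_* rest) (𝟙-∧ placed shape) ⟩
      𝟙 placed * 𝟙 shape * rest     ≡⟨ *-assoc (𝟙 placed) (𝟙 shape) rest ⟩
      𝟙 placed * (𝟙 shape * rest)   ≡⟨ weigh (T-dec placed) ⟩
      𝟙 placed * blockWeight N R ∣ Tb ∩ Sp ∣ ∣ Tb ∖ Sp ∣ ∎
      where
      placed shape : Bool
      placed = single e ⊆ᵇ Tb ∧ Tb ⊆ᵇ U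
      shape  = (∣ Tb ∩ Sp ∣ ≤ᵇ 1) ∧ S ∣ Tb ∣
      rest : ℕ
      rest = bell (U ∖ Tb) (Sp ∖ Tb)

      remainder : T placed → rest ≡ B S (N ∸ ∣ Tb ∖ Sp ∣) (R ∸ ∣ Tb ∩ Sp ∣)
      remainder p = begin
        rest
          ≡⟨ ih (U ∖ Tb) (Sp ∖ Tb) (≤-pred (≤-trans (∣∖∣-< U Tb e e∈U e∈Tb) small))
                (λ i s → ∧-intro (Sp⊆U i (∧-fst s)) (∧-snd {Sp i} s)) ⟩
        B S ∣ (U ∖ Tb) ∖ (Sp ∖ Tb) ∣ ∣ Sp ∖ Tb ∣
          ≡⟨ cong₂ (B S) (trans (∣∣-cong (λ i → ∖-∖-absorb (U i) (Tb i) (Sp i))) (remaining-ordinary U Sp Tb Tb⊆U))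
                         (trans (∣∣-cong (λ i → sym (restrict-⊆ (U i) (Tb i) (Sp i) (Sp⊆U i))))
                                (remaining-special U Sp Tb Sp⊆U)) ⟩
        B S (N ∸ ∣ Tb ∖ Sp ∣) (R ∸ ∣ Tb ∩ Sp ∣) ∎
        where
        e∈Tb : T (Tb e)
        e∈Tb = subst T (single-⊆ᵇ e Tb) (∧-fst p)
        Tb⊆U : Tb ⊆ U
        Tb⊆U = ⊆ᵇ-sound (∧-snd {single e ⊆ᵇ Tb} p)

      weigh : T placed ⊎ (T placed → ⊥) → 𝟙 placed * (𝟙 shape * rest) ≡ 𝟙 placed * blockWeight N R ∣ Tb ∩ Sp ∣ ∣ Tb ∖ Sp ∣
      weigh (inj₂ ¬p) = 𝟙-vanish _ _ (T-false ¬p)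
      weigh (inj₁ p)  = cong (𝟙 placed *_) (begin
        𝟙 shape * rest             ≡⟨ 𝟙-*-if shape rest ⟩
        (if shape then rest else 0)
          ≡⟨ cong₂ (λ s n → if (∣ Tb ∩ Sp ∣ ≤ᵇ 1) ∧ S s then n else 0) (∣∣-split Tb Sp) (remainder p) ⟩
        blockWeight N R ∣ Tb ∩ Sp ∣ ∣ Tb ∖ Sp ∣ ∎)

    decompose-below : bell U Sp ≡ blockSum N R (Sp e)
    decompose-below = begin
      bell U Sp
        ≡⟨ decomposition e∈U ⟩
      sumL (λ Tb → 𝟙 (isBlock Tb) * bell (U ∖ Tb) (Sp ∖ Tb)) (allSubs M)
        ≡⟨ sumL-cong block-term (allSubs M) ⟩
      subsetSum (single e) U Sp (blockWeight N R)
        ≡⟨ subsetSum≡binomSum₂ (single e) U Sp (blockWeight N R) e⊆U ⟩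
      binomSum₂ (∣ (U ∖ single e) ∩ Sp ∣) (∣ (U ∖ single e) ∖ Sp ∣)
                (λ a b → blockWeight N R (∣ single e ∩ Sp ∣ + a) (∣ single e ∖ Sp ∣ + b))
        ≡⟨ cong₂ (λ k l → binomSum₂ k l (λ a b → blockWeight N R (∣ single e ∩ Sp ∣ + a) (∣ single e ∖ Sp ∣ + b)))
                 (remaining-special U Sp (single e) Sp⊆U) (remaining-ordinary U Sp (single e) e⊆U) ⟩
      shifted (∣ single e ∩ Sp ∣) (∣ single e ∖ Sp ∣)
        ≡⟨ cong₂ shifted (∣single∩∣ e Sp) (∣single∩∣ e (λ i → not (Sp i))) ⟩
      blockSum N R (Sp e) ∎
      where
      shifted : ℕ → ℕ → ℕ
      shifted c d = binomSum₂ (R ∸ c) (N ∸ d) (λ a b → blockWeight N R (c + a) (d + b))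
      e⊆U : single e ⊆ U
      e⊆U i s = subst (λ k → T (U k)) (eqFin-sound s) e∈U

  pivot : ∀ {M} (U Sp : Sub M) → Sp ⊆ U → ∀ {u} → ∣ U ∣ ≡ suc u →
          Σ (Fin M) λ e → T (U e) × Sp e ≡ (0 <ᵇ ∣ Sp ∣)
  pivot U Sp Sp⊆U ∣U∣≡ with ∣ Sp ∣ in ∣Sp∣≡
  ... | zero  = let (e , e∈U) = ∣∣-pos U ∣U∣≡ in e , e∈U , T-false (∣∣-zero Sp ∣Sp∣≡ e)
  ... | suc _ = let (e , e∈Sp) = ∣∣-pos Sp ∣Sp∣≡ in e , Sp⊆U e e∈Sp , T-true e∈Sp

  decompose-at-pivot : ∀ {f} → BellUpTo f → ∀ {M} (U Sp : Sub M) → Sp ⊆ U → ∀ {u} → ∣ U ∣ ≡ suc u →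
                       ∣ U ∣ ≤ suc f → bell U Sp ≡ blockSum ∣ U ∖ Sp ∣ ∣ Sp ∣ (0 <ᵇ ∣ Sp ∣)
  decompose-at-pivot ih U Sp Sp⊆U ∣U∣≡ small with pivot U Sp Sp⊆U ∣U∣≡
  ... | e , e∈U , kind = trans (Pivot.decompose-below U Sp e Sp⊆U e∈U ih small) (cong (blockSum _ _) kind)

  bell-empty-B : ∀ {M} (U Sp : Sub M) → ∣ U ∣ ≡ 0 → Sp ⊆ U → bell U Sp ≡ B S ∣ U ∖ Sp ∣ ∣ Sp ∣
  bell-empty-B U Sp ∣U∣≡0 Sp⊆U = trans (bell-empty U Sp ∣U∣≡0) (sym (cong₂ (B S)
    (∣∣-empty (U ∖ Sp) (λ i x → ∣∣-zero U ∣U∣≡0 i (∧-fst x)))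
    (∣∣-empty Sp (λ i x → ∣∣-zero U ∣U∣≡0 i (Sp⊆U i x)))))

  -- bell U Sp = B S ∣U ∖ Sp∣ ∣Sp∣, by strong induction on ∣U∣: (U, Sp) and the canonical
  -- configuration with the same sizes decompose into the same blockSum at their pivots.
  bell≡B : ∀ f → BellUpTo f
  bell≡B zero    U Sp small Sp⊆U = bell-empty-B U Sp (n≤0⇒n≡0 small) Sp⊆U
  bell≡B (suc f) U Sp small Sp⊆U = by-size ∣ U ∣ refl
    where
    by-size : ∀ n → ∣ U ∣ ≡ n → bell U Sp ≡ B S ∣ U ∖ Sp ∣ ∣ Sp ∣
    by-size zero    ∣U∣≡0 = bell-empty-B U Sp ∣U∣≡0 Sp⊆U
    by-size (suc u) ∣U∣≡  = begin
      bell U Sp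
        ≡⟨ decompose-at-pivot (bell≡B f) U Sp Sp⊆U ∣U∣≡ small ⟩
      blockSum N R (0 <ᵇ R)
        ≡⟨ cong₂ (λ n r → blockSum n r (0 <ᵇ r)) (sym (canonical-ordinary N R)) (sym (canonical-special N R)) ⟩
      blockSum ∣ full {N + R} ∖ firstPoints R ∣ ∣ firstPoints {N + R} R ∣ (0 <ᵇ ∣ firstPoints {N + R} R ∣)
        ≡⟨ sym (decompose-at-pivot (bell≡B f) (full {N + R}) (firstPoints R) (λ _ _ → tt) ∣full∣≡
                                   (subst (_≤ suc f) (trans ∣U∣≡ (sym ∣full∣≡)) small)) ⟩
      bell (full {N + R}) (firstPoints R)
        ≡⟨ sym (B≡bell N R) ⟩
      B S N R ∎
      where
      N R : ℕ
      N = ∣ U ∖ Sp ∣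
      R = ∣ Sp ∣
      ∣full∣≡ : ∣ full {N + R} ∣ ≡ suc u
      ∣full∣≡ = trans (∣full∣ (N + R)) (trans (sym (∣∣-⊆ U Sp Sp⊆U)) ∣U∣≡)

  decompose : ∀ {M} (U Sp : Sub M) e → Sp ⊆ U → T (U e) → bell U Sp ≡ blockSum ∣ U ∖ Sp ∣ ∣ Sp ∣ (Sp e)
  decompose U Sp e Sp⊆U e∈U = Pivot.decompose-below U Sp e Sp⊆U e∈U (bell≡B ∣ U ∣) (n≤1+n ∣ U ∣)

  B-blockSum : ∀ n r (e : Fin (n + r)) → B S n r ≡ blockSum n r (firstPoints r e)
  B-blockSum n r e = begin
    B S n r
      ≡⟨ B≡bell n r ⟩
    bell (full {n + r}) (firstPoints r)
      ≡⟨ decompose full (firstPoints r) e (λ _ _ → tt) tt ⟩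
    blockSum ∣ full {n + r} ∖ firstPoints r ∣ ∣ firstPoints {n + r} r ∣ (firstPoints r e)
      ≡⟨ cong₂ (λ a b → blockSum a b (firstPoints r e)) (canonical-ordinary n r) (canonical-special n r) ⟩
    blockSum n r (firstPoints r e) ∎

  firstSum secondSum : ℕ → ℕ → ℕ
  firstSum  n r = binomSum n (λ b → if S (suc b) then B S (n ∸ b) r else 0)
  secondSum n r = binomSum n (λ b → if S (suc (suc b)) then B S (n ∸ b) r else 0)

  -- Expanding at the special point 1: its block has no other special point.
  B-special : ∀ n r → B S n (suc r) ≡ firstSum n r
  B-special n r = begin
    B S n (suc r)
      ≡⟨ B-blockSum n (suc r) e ⟩
    blockSum n (suc r) (firstPoints (suc r) e)
      ≡⟨ cong (λ k → blockSum n (suc r) (k <ᵇ suc r)) (toℕ-fromℕ< 0<n+r) ⟩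
    blockSum n (suc r) true
      ≡⟨ binomSum₂-atMostOne r n _ (λ _ _ → refl) ⟩
    firstSum n r + r * binomSum n (λ _ → 0)
      ≡⟨ cong (λ z → firstSum n r + r * z) (binomSum-zero n) ⟩
    firstSum n r + r * 0
      ≡⟨ trans (cong (firstSum n r +_) (*-zeroʳ r)) (+-identityʳ _) ⟩
    firstSum n r ∎
    where
    0<n+r : 0 < n + suc r
    0<n+r = ≤-trans (s≤s z≤n) (m≤n+m (suc r) n)
    e : Fin (n + suc r)
    e = fromℕ< 0<n+r

  -- Expanding at an ordinary point: its block has no or exactly one special point.
  B-ordinary : ∀ n r → B S (suc n) r ≡ firstSum n r + r * secondSum n (r ∸ 1)
  B-ordinary n r = begin
    B S (suc n) r
      ≡⟨ B-blockSum (suc n) r e ⟩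
    blockSum (suc n) r (firstPoints r e)
      ≡⟨ cong (blockSum (suc n) r) (trans (cong (_<ᵇ r) (toℕ-fromℕ< r<n+r)) (<ᵇ-irrefl r)) ⟩
    blockSum (suc n) r false
      ≡⟨ binomSum₂-atMostOne r n _ (λ _ _ → refl) ⟩
    firstSum n r + r * secondSum n (r ∸ 1) ∎
    where
    r<n+r : r < suc n + r
    r<n+r = m<n+m r (s≤s z≤n)
    e : Fin (suc n + r)
    e = fromℕ< r<n+r

sumTo : ℕ → (ℕ → ℕ) → ℕ
sumTo zero    h = 0
sumTo (suc k) h = h 0 + sumTo k (λ i → h (suc i))

sumTo-cong : ∀ k {h h′ : ℕ → ℕ} → (∀ i → h i ≡ h′ i) → sumTo k h ≡ sumTo k h′
sumTo-cong zero    eq = refl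
sumTo-cong (suc k) eq = cong₂ _+_ (eq 0) (sumTo-cong k (λ i → eq (suc i)))

sumTo-+ : ∀ k (f g : ℕ → ℕ) → sumTo k (λ i → f i + g i) ≡ sumTo k f + sumTo k g
sumTo-+ zero    f g = refl
sumTo-+ (suc k) f g =
  trans (cong (f 0 + g 0 +_) (sumTo-+ k (λ i → f (suc i)) (λ i → g (suc i)))) (interchange (f 0) (g 0) _ _)

sumTo-*ˡ : ∀ k c (f : ℕ → ℕ) → sumTo k (λ i → c * f i) ≡ c * sumTo k f
sumTo-*ˡ zero    c f = sym (*-zeroʳ c)
sumTo-*ˡ (suc k) c f = trans (cong (c * f 0 +_) (sumTo-*ˡ k c (λ i → f (suc i)))) (sym (*-distribˡ-+ c (f 0) _))

sumTo-last : ∀ k (h : ℕ → ℕ) → sumTo (suc k) h ≡ sumTo k h + h k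
sumTo-last zero    h = +-comm (h 0) 0
sumTo-last (suc k) h = trans (cong (h 0 +_) (sumTo-last k (λ i → h (suc i)))) (sym (+-assoc (h 0) _ _))

ΣS≡sumTo : ∀ S a b g → ΣS S a b g ≡ sumTo (suc b ∸ a) (λ i → if S (a + i) then g (a + i) else 0)
ΣS≡sumTo S a b g = sum-shifted (suc b ∸ a) (λ i → i)
  where
  sum-shifted : ∀ k (f : ℕ → ℕ) →
    sum (map (λ s → if S s then g s else 0) (map (a +_) (applyUpTo f k))) ≡ sumTo k (λ i → if S (a + f i) then g (a + f i) else 0)
  sum-shifted zero    f = refl
  sum-shifted (suc k) f = cong (_ +_) (sum-shifted k (λ i → f (suc i)))

*-if : ∀ c s x → c * (if s then x else 0) ≡ (if s then c * x else 0)
*-if c true  x = refl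
*-if c false x = *-zeroʳ c

binomSum-closed : ∀ l χ → binomSum l χ ≡ sumTo (suc l) (λ b → (l C b) * χ b)
binomSum-closed zero    χ = sym (trans (+-identityʳ _) (+-identityʳ _))
binomSum-closed (suc l) χ = begin
  binomSum l χ + binomSum l χ′
    ≡⟨ cong₂ _+_ (binomSum-closed l χ) (binomSum-closed l χ′) ⟩
  (1 * χ 0 + sumTo l shifted) + sumTo (suc l) (λ b → (l C b) * χ′ b)
    ≡⟨ +-assoc (1 * χ 0) _ _ ⟩
  1 * χ 0 + (sumTo l shifted + sumTo (suc l) (λ b → (l C b) * χ′ b))
    ≡⟨ cong (λ z → 1 * χ 0 + (z + sumTo (suc l) (λ b → (l C b) * χ′ b))) extend ⟩
  1 * χ 0 + (sumTo (suc l) shifted + sumTo (suc l) (λ b → (l C b) * χ′ b))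
    ≡⟨ cong (1 * χ 0 +_) (trans (+-comm (sumTo (suc l) shifted) _) (sym (sumTo-+ (suc l) (λ b → (l C b) * χ′ b) shifted))) ⟩
  1 * χ 0 + sumTo (suc l) (λ b → (l C b) * χ′ b + (l C suc b) * χ′ b)
    ≡⟨ cong (1 * χ 0 +_) (sumTo-cong (suc l) λ b →
         trans (sym (*-distribʳ-+ (χ′ b) (l C b) _)) (cong (_* χ′ b) (nCk+nC[k+1]≡[n+1]C[k+1] l b))) ⟩
  1 * χ 0 + sumTo (suc l) (λ b → (suc l C suc b) * χ′ b) ∎
  where
  χ′ shifted : ℕ → ℕ
  χ′ b = χ (suc b)
  shifted b = (l C suc b) * χ′ b
  -- the extra term C(l, l+1) vanishes
  extend : sumTo l shifted ≡ sumTo (suc l) shifted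
  extend = sym (trans (sumTo-last l shifted)
    (trans (cong (λ z → sumTo l shifted + z * χ′ l) (k>n⇒nCk≡0 (n<1+n l))) (+-identityʳ _)))

binomSum-if : ∀ n (s : ℕ → Bool) (x : ℕ → ℕ) →
  binomSum n (λ b → if s b then x b else 0) ≡ sumTo (suc n) (λ b → if s b then (n C b) * x b else 0)
binomSum-if n s x = trans (binomSum-closed n _) (sumTo-cong (suc n) λ b → *-if (n C b) (s b) (x b))

absorption : ∀ n k → suc k * (suc n C suc k) ≡ suc n * (n C k)
absorption zero    zero    = refl
absorption zero    (suc k) = *-zeroʳ (suc (suc k))
absorption (suc n) zero    = trans (+-identityʳ _) (trans (nC1≡n (suc (suc n))) (sym (*-identityʳ (suc (suc n)))))
absorption (suc n) (suc k) = begin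
  suc (suc k) * (suc (suc n) C suc (suc k))
    ≡⟨ cong (suc (suc k) *_) (sym (nCk+nC[k+1]≡[n+1]C[k+1] (suc n) (suc k))) ⟩
  suc (suc k) * (c₁ + c₂)
    ≡⟨ *-distribˡ-+ (suc (suc k)) c₁ c₂ ⟩
  (c₁ + suc k * c₁) + suc (suc k) * c₂
    ≡⟨ cong₂ (λ x y → (c₁ + x) + y) (absorption n k) (absorption n (suc k)) ⟩
  (c₁ + suc n * (n C k)) + suc n * (n C suc k)
    ≡⟨ +-assoc c₁ _ _ ⟩
  c₁ + (suc n * (n C k) + suc n * (n C suc k))
    ≡⟨ cong (c₁ +_) (trans (sym (*-distribˡ-+ (suc n) (n C k) _)) (cong (suc n *_) (nCk+nC[k+1]≡[n+1]C[k+1] n k))) ⟩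
  c₁ + suc n * c₁ ∎
  where
  c₁ c₂ : ℕ
  c₁ = suc n C suc k
  c₂ = suc n C suc (suc k)

absorb-sum : ∀ m χ → suc m * binomSum m χ ≡ sumTo (suc m) (λ i → suc i * (suc m C suc i) * χ i)
absorb-sum m χ = begin
  suc m * binomSum m χ
    ≡⟨ cong (suc m *_) (binomSum-closed m χ) ⟩
  suc m * sumTo (suc m) (λ i → (m C i) * χ i)
    ≡⟨ sym (sumTo-*ˡ (suc m) (suc m) (λ i → (m C i) * χ i)) ⟩
  sumTo (suc m) (λ i → suc m * ((m C i) * χ i))
    ≡⟨ sumTo-cong (suc m) (λ i → trans (sym (*-assoc (suc m) (m C i) (χ i))) (cong (_* χ i) (sym (absorption m i)))) ⟩
  sumTo (suc m) (λ i → suc i * (suc m C suc i) * χ i) ∎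

weighted-sum : ∀ n χ → sumTo (suc n) (λ i → suc i * (n C i) * χ i) ≡ binomSum n χ + n * binomSum (n ∸ 1) (λ j → χ (suc j))
weighted-sum n χ = begin
  sumTo (suc n) (λ i → suc i * (n C i) * χ i)
    ≡⟨ sumTo-cong (suc n) (λ i → *-distribʳ-+ (χ i) (n C i) (i * (n C i))) ⟩
  sumTo (suc n) (λ i → (n C i) * χ i + i * (n C i) * χ i)
    ≡⟨ sumTo-+ (suc n) (λ i → (n C i) * χ i) (λ i → i * (n C i) * χ i) ⟩
  sumTo (suc n) (λ i → (n C i) * χ i) + sumTo n (λ j → suc j * (n C suc j) * χ (suc j))
    ≡⟨ cong₂ _+_ (sym (binomSum-closed n χ)) (shifted n) ⟩
  binomSum n χ + n * binomSum (n ∸ 1) (λ j → χ (suc j)) ∎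
  where
  shifted : ∀ n → sumTo n (λ j → suc j * (n C suc j) * χ (suc j)) ≡ n * binomSum (n ∸ 1) (λ j → χ (suc j))
  shifted zero    = refl
  shifted (suc m) = sym (absorb-sum m (λ j → χ (suc j)))

module Identities (S : Subsetℕ) where
  open BellRecursion S

  -- n Σ_{j ≤ n−1} C(n−1,j) [S(j+2)] B(n−1−j, r), the part shared by n·B(n,r+1) and the second sum.
  pairTerm : ℕ → ℕ → ℕ
  pairTerm n r = n * binomSum (n ∸ 1) (λ j → if S (suc (suc j)) then B S (n ∸ suc j) r else 0)

  -- Expansion at a special point.
  first-identity : ∀ n r → B S n (suc r) ≡ ΣS S 1 (suc n) (λ s → (n C (s ∸ 1)) * B S (suc n ∸ s) r)
  first-identity n r = begin
    B S n (suc r)  ≡⟨ B-special n r ⟩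
    firstSum n r   ≡⟨ binomSum-if n (λ b → S (suc b)) (λ b → B S (n ∸ b) r) ⟩
    sumTo (suc n) (λ i → if S (suc i) then (n C i) * B S (n ∸ i) r else 0)
                   ≡⟨ sym (ΣS≡sumTo S 1 (suc n) _) ⟩
    ΣS S 1 (suc n) (λ s → (n C (s ∸ 1)) * B S (suc n ∸ s) r) ∎

  -- Expansion at an ordinary point.
  third-identity : ∀ n r → B S (suc n) r ≡
    B S n (suc r) + r * ΣS S 2 (suc (suc n)) (λ s → (n C (s ∸ 2)) * B S (suc (suc n) ∸ s) (r ∸ 1))
  third-identity n r = begin
    B S (suc n) r
      ≡⟨ B-ordinary n r ⟩
    firstSum n r + r * secondSum n (r ∸ 1)
      ≡⟨ cong₂ (λ x y → x + r * y) (sym (B-special n r))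
               (trans (binomSum-if n (λ b → S (suc (suc b))) (λ b → B S (n ∸ b) (r ∸ 1))) (sym (ΣS≡sumTo S 2 (suc (suc n)) _))) ⟩
    B S n (suc r) + r * ΣS S 2 (suc (suc n)) (λ s → (n C (s ∸ 2)) * B S (suc (suc n) ∸ s) (r ∸ 1)) ∎

  -- n·B(n,r), from the expansion at an ordinary point and absorption.
  ordinary-part : ∀ n r → n * B S n r ≡
    sumTo n (λ i → if S (suc i) then suc i * (n C suc i) * B S (n ∸ suc i) r else 0) + r * pairTerm n (r ∸ 1)
  ordinary-part zero    r = sym (*-zeroʳ r)
  ordinary-part (suc m) r = begin
    suc m * B S (suc m) r
      ≡⟨ cong (suc m *_) (B-ordinary m r) ⟩
    suc m * (firstSum m r + r * secondSum m (r ∸ 1))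
      ≡⟨ *-distribˡ-+ (suc m) (firstSum m r) _ ⟩
    suc m * firstSum m r + suc m * (r * secondSum m (r ∸ 1))
      ≡⟨ cong₂ _+_ (trans (absorb-sum m (λ i → if S (suc i) then B S (m ∸ i) r else 0))
                          (sumTo-cong (suc m) λ i → *-if (suc i * (suc m C suc i)) (S (suc i)) (B S (m ∸ i) r)))
                   (x∙yz≈y∙xz (suc m) r _) ⟩
    sumTo (suc m) (λ i → if S (suc i) then suc i * (suc m C suc i) * B S (m ∸ i) r else 0) + r * pairTerm (suc m) (r ∸ 1) ∎

  -- r·B(n,r), from the expansion at a special point when r > 0.
  special-part : ∀ n r → r * B S n r ≡ r * firstSum n (r ∸ 1)
  special-part n zero    = refl
  special-part n (suc r) = cong (suc r *_) (B-special n r)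

  second-sum : ∀ n r → sumTo (suc n) (λ i → if S (suc i) then suc i * (n C i) * B S (n ∸ i) r else 0)
                     ≡ firstSum n r + pairTerm n r
  second-sum n r = begin
    sumTo (suc n) (λ i → if S (suc i) then suc i * (n C i) * B S (n ∸ i) r else 0)
      ≡⟨ sumTo-cong (suc n) (λ i → sym (*-if (suc i * (n C i)) (S (suc i)) (B S (n ∸ i) r))) ⟩
    sumTo (suc n) (λ i → suc i * (n C i) * (if S (suc i) then B S (n ∸ i) r else 0))
      ≡⟨ weighted-sum n (λ i → if S (suc i) then B S (n ∸ i) r else 0) ⟩
    firstSum n r + pairTerm n r ∎

  -- (n + r)·B(n,r) = n·B(n,r) + r·B(n,r), each part rewritten as above.
  second-identity : ∀ n r → (n + r) * B S n r ≡
         ΣS S 1 n (λ s → s * (n C s) * B S (n ∸ s) r)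
         + r * ΣS S 1 (suc n) (λ s → s * (n C (s ∸ 1)) * B S (suc n ∸ s) (r ∸ 1))
  second-identity n r = begin
    (n + r) * B S n r
      ≡⟨ *-distribʳ-+ (B S n r) n r ⟩
    n * B S n r + r * B S n r
      ≡⟨ cong₂ _+_ (ordinary-part n r) (special-part n r) ⟩
    (W₁ + r * pairTerm n (r ∸ 1)) + r * firstSum n (r ∸ 1)
      ≡⟨ regroup W₁ r (pairTerm n (r ∸ 1)) (firstSum n (r ∸ 1)) ⟩
    W₁ + r * (firstSum n (r ∸ 1) + pairTerm n (r ∸ 1))
      ≡⟨ cong₂ (λ x y → x + r * y) (sym (ΣS≡sumTo S 1 n _)) (sym (trans (ΣS≡sumTo S 1 (suc n) _) (second-sum n (r ∸ 1)))) ⟩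
    ΣS S 1 n (λ s → s * (n C s) * B S (n ∸ s) r)
      + r * ΣS S 1 (suc n) (λ s → s * (n C (s ∸ 1)) * B S (suc n ∸ s) (r ∸ 1)) ∎
    where
    W₁ : ℕ
    W₁ = sumTo n (λ i → if S (suc i) then suc i * (n C suc i) * B S (n ∸ suc i) r else 0)
    regroup : ∀ w r p f → (w + r * p) + r * f ≡ w + r * (f + p)
    regroup w r p f = solve 4 (λ w r p f → (w :+ r :* p) :+ r :* f := w :+ r :* (f :+ p)) refl w r p f
      where open +-*-Solver using (solve; _:+_; _:*_; _:=_)

mainTheorem2 : (S : Subsetℕ) → S 0 ≡ false → (n r : ℕ) →
    (B S n (suc r) ≡ ΣS S 1 (suc n) (λ s → (n C (s ∸ 1)) * B S (suc n ∸ s) r))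
    × ((n + r) * B S n r ≡
         ΣS S 1 n (λ s → s * (n C s) * B S (n ∸ s) r)
         + r * ΣS S 1 (suc n) (λ s → s * (n C (s ∸ 1)) * B S (suc n ∸ s) (r ∸ 1)))
    × (B S (suc n) r ≡
         B S n (suc r) + r * ΣS S 2 (suc (suc n)) (λ s → (n C (s ∸ 2)) * B S (suc (suc n) ∸ s) (r ∸ 1)))
mainTheorem2 S _ n r = first-identity n r , second-identity n r , third-identity n r
  where open Identities S
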